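{- The map $\phi_N:\mathrm{C}_N(d_K)\to\mathrm{Cl}(\mathfrak{n})$, $[Q]\mapsto$ the ray class containing $[\omega_Q,1]$, is injective.
   Context: Let $K$ be an imaginary quadratic field of discriminant $d_K$, $K\neq\mathbb{Q}(\sqrt{ -1}),\mathbb{Q}(\sqrt{ -3})$ (so $\mathcal{O}_K^*=\{\pm1\}$), $N$ a positive integer, $\mathfrak{n}=N\mathcal{O}_K$. $\mathcal{Q}_N(d_K)$ is the set of primitive positive definite forms $ax^2+bxy+cy^2\in\mathbb{Z}[x,y]$ of discriminant $d_K$ with $\gcd(N,a)=1$; $Q\sim_N Q'$ iff $Q'\left(\begin{bmatrix}x\\ y\end{bmatrix}\right)=Q\left(\sigma\begin{bmatrix}x\\ y\end{bmatrix}\right)$ for some $\sigma\in\pm\Gamma_1(N)=\{\sigma\in\mathrm{SL}_2(\mathbb{Z}):\sigma\equiv\pm\begin{bmatrix}1&*\\ 0&1\end{bmatrix}\pmod N\}$; $\mathrm{C}_N(d_K)=\mathcal{Q}_N(d_K)/\sim_N$. $\omega_Q$ is the zero of $Q(x,1)$ in the upper half-plane, and $\mathrm{Cl}(\mathfrak{n})$ is the ray class group modulo $\mathfrak{n}$. -}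

module Defs where

open import Data.Nat as ℕ using (ℕ)
import Data.Nat.GCD as ℕG
import Data.Nat.Divisibility as ℕD
open import Data.Integer as ℤ using (ℤ; +_; ∣_∣)
open import Data.Integer.Divisibility as ℤD using ()
open import Data.Rational as ℚ using (ℚ; 0ℚ; 1ℚ)
open import Data.Product using (Σ; ∃; ∃-syntax; _×_; _,_)
open import Data.Sum using (_⊎_)
open import Relation.Binary.PropositionalEquality using (_≡_)
open import Relation.Nullary using (¬_)

_≡_[mod_] : ℤ → ℤ → ℕ → Set
x ≡ y [mod N ] = (+ N) ℤD.∣ (x ℤ.- y)

SquareFree : ℕ → Set
SquareFree n = ∀ m → (m ℕ.* m) ℕD.∣ n → m ≡ 1

Fundamental : ℤ → Set
Fundamental d =
    (d ≡ + 1 [mod 4 ] × SquareFree ∣ d ∣)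
  ⊎ (Σ ℤ λ m → d ≡ ℤ.+ 4 ℤ.* m × (m ≡ + 2 [mod 4 ] ⊎ m ≡ + 3 [mod 4 ]) × SquareFree ∣ m ∣)

-- d is the discriminant of an imaginary quadratic field K ≠ ℚ(√-1), ℚ(√-3)
ImagQuadDisc : ℤ → Set
ImagQuadDisc d = Fundamental d × d ℤ.< + 0 × ¬ (d ≡ ℤ.- + 3) × ¬ (d ≡ ℤ.- + 4)

-- The field K = ℚ(√d): the element x + y√d is represented by (x , y).
-- We fix the embedding K ⊂ ℂ with √d = i√|d|, so Im(x + y√d) > 0 iff y > 0.

module Field (d : ℤ) where

  record K : Set where
    constructor _+_√d
    field
      re : ℚ
      sq : ℚ
  open K public

  ιℤ : ℤ → ℚ
  ιℤ z = z ℚ./ 1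

  dℚ : ℚ
  dℚ = ιℤ d

  infixl 6 _⊕_ _⊖_
  infixl 7 _⊗_ _·_

  _⊕_ : K → K → K
  (x + y √d) ⊕ (x' + y' √d) = (x ℚ.+ x') + (y ℚ.+ y') √d

  ⊝_ : K → K
  ⊝ (x + y √d) = (ℚ.- x) + (ℚ.- y) √d

  _⊖_ : K → K → K
  u ⊖ v = u ⊕ (⊝ v)

  _⊗_ : K → K → K
  (x + y √d) ⊗ (x' + y' √d) =
    (x ℚ.* x' ℚ.+ dℚ ℚ.* y ℚ.* y') + (x ℚ.* y' ℚ.+ y ℚ.* x') √d

  _·_ : ℤ → K → K
  m · u = (ιℤ m + 0ℚ √d) ⊗ u

  fromℤ : ℤ → K
  fromℤ m = ιℤ m + 0ℚ √d

  0K 1K : K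
  0K = fromℤ (+ 0)
  1K = fromℤ (+ 1)

  -- θ = (d + √d)/2; O_K = ℤ[θ] = ℤ + ℤθ
  θ : K
  θ = (d ℚ./ 2) + (+ 1 ℚ./ 2) √d

  -- an element of O_K, given by its coordinates (m , n) ↦ m + nθ
  O : Set
  O = ℤ × ℤ

  toK : O → K
  toK (m , n) = fromℤ m ⊕ (n · θ)

  -- α is prime to 𝔫 = N O_K :  α O_K + N O_K = O_K
  PrimeTo : ℕ → O → Set
  PrimeTo N α = ∃[ u ] ∃[ v ] (toK u ⊗ toK α ⊕ toK v ⊗ fromℤ (+ N) ≡ 1K)

  CongO : ℕ → O → O → Set
  CongO N α β = ∃[ γ ] (toK α ⊖ toK β ≡ fromℤ (+ N) ⊗ toK γ)

  -- ℤ-lattices [u , v] = ℤu + ℤv in K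
  record Lattice : Set where
    constructor [_,_]
    field
      g₁ g₂ : K
  open Lattice public

  _∈L_ : K → Lattice → Set
  x ∈L [ u , v ] = ∃[ m ] ∃[ n ] (x ≡ m · u ⊕ n · v)

  _⊆L_ : Lattice → Lattice → Set
  L ⊆L L' = g₁ L ∈L L' × g₂ L ∈L L'

  _≈L_ : Lattice → Lattice → Set
  L ≈L L' = L ⊆L L' × L' ⊆L L

  scaleL : K → Lattice → Lattice
  scaleL λ' [ u , v ] = [ λ' ⊗ u , λ' ⊗ v ]

  -- Two fractional ideals (prime to 𝔫) lie in the same ray class modulo 𝔫 = N O_K
  -- iff 𝔟 = ν 𝔞 for some ν ∈ K^* with ν ≡* 1 mod 𝔫, i.e. ν = α/β with
  -- α, β ∈ O_K nonzero, prime to 𝔫, α ≡ β (mod 𝔫).  ν𝔞 = 𝔟 ⇔ α𝔞 = β𝔟.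
  SameRayClass : ℕ → Lattice → Lattice → Set
  SameRayClass N 𝔞 𝔟 =
    ∃[ α ] ∃[ β ] (¬ (toK α ≡ 0K) × ¬ (toK β ≡ 0K) × PrimeTo N α × PrimeTo N β
                  × CongO N α β × scaleL (toK α) 𝔞 ≈L scaleL (toK β) 𝔟)

record Form : Set where
  constructor form
  field
    a b c : ℤ
open Form public

evalF : Form → ℤ → ℤ → ℤ
evalF (form a b c) x y = a ℤ.* x ℤ.* x ℤ.+ b ℤ.* x ℤ.* y ℤ.+ c ℤ.* y ℤ.* y

disc : Form → ℤ
disc (form a b c) = b ℤ.* b ℤ.- ℤ.+ 4 ℤ.* a ℤ.* c

Primitive : Form → Set
Primitive (form a b c) = ℕG.gcd ∣ a ∣ (ℕG.gcd ∣ b ∣ ∣ c ∣) ≡ 1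

InQ : ℕ → ℤ → Form → Set
InQ N d Q = Primitive Q × disc Q ≡ d × + 0 ℤ.< a Q × ℕG.gcd N ∣ a Q ∣ ≡ 1

record Mat : Set where
  constructor mat
  field
    p q r s : ℤ
open Mat public

InPmΓ₁ : ℕ → Mat → Set
InPmΓ₁ N (mat p q r s) =
  p ℤ.* s ℤ.- q ℤ.* r ≡ + 1 ×
  ((p ≡ + 1 [mod N ] × r ≡ + 0 [mod N ] × s ≡ + 1 [mod N ])
   ⊎ (p ≡ ℤ.- + 1 [mod N ] × r ≡ + 0 [mod N ] × s ≡ ℤ.- + 1 [mod N ]))

_∼[_]_ : Form → ℕ → Form → Set
Q ∼[ N ] Q' = ∃[ σ ] (InPmΓ₁ N σ ×
  ∀ x y → evalF Q' x y ≡ evalF Q (p σ ℤ.* x ℤ.+ q σ ℤ.* y) (r σ ℤ.* x ℤ.+ s σ ℤ.* y))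

-- ω is the zero of Q(x,1) in the upper half-plane
module _ (d : ℤ) where
  open Field d
  IsOmega : Form → K → Set
  IsOmega Q ω = fromℤ (a Q) ⊗ ω ⊗ ω ⊕ fromℤ (b Q) ⊗ ω ⊕ fromℤ (c Q) ≡ 0K
                × 0ℚ ℚ.< sq ω

{-# OPTIONS --safe #-}
-- Write ν = α/β, so that ν[ω_Q, 1] = [ω_Q', 1], and let σ = (p q ; r s) be given by
-- νω_Q = pω_Q' + q and ν = rω_Q' + s; the reverse inclusion makes σ invertible over ℤ.
-- As 2aω_Q + b = √d = 2a'ω_Q' + b', comparing coefficients of 1 and ω_Q' in νω_Q = pω_Q' + q
-- gives 2ap + br = 2a's - b'r and 2aq + bs = b's - 2c'r. Hence a·det σ = Q'(s, -r) ≥ 0, so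
-- det σ = 1, and completing the square turns these relations into Q' = Q ∘ σ.
-- Finally a'ω_Q' ∈ 𝒪_K, so a'(ν - 1) ∈ 𝒪_K; since ν - 1 = (α - β)/β with β invertible modulo N
-- and α - β ∈ N𝒪_K, even a'(ν - 1) ∈ N𝒪_K. Its coordinates give N ∣ r and N ∣ a'(s - 1), and
-- gcd(N, a') = 1 yields s ≡ 1, hence p ≡ 1 (mod N).
module Submission where

open import Defs
open import Data.Nat as ℕ using (ℕ; suc; _≥_)
import Data.Nat.Properties as ℕP
import Data.Nat.Coprimality as Coprime
import Data.Nat.GCD as ℕGCD
import Data.Nat.Divisibility as ℕDivisibility
open import Data.Integer as ℤ using (ℤ; +_; +[1+_]; -[1+_])
import Data.Integer.Properties as ℤP
import Data.Integer.DivMod as ℤDivMod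
import Data.Integer.Divisibility.Signed as ℤDivisibility
open import Data.Integer.Tactic.RingSolver using () renaming (ring to ℤ-ring)
open import Data.Rational as ℚ using (ℚ; mkℚ; 0ℚ; 1ℚ; ½)
import Data.Rational.Properties as ℚP
import Data.Rational.Unnormalised as ℚᵘ
import Data.Rational.Unnormalised.Properties as ℚU
import Algebra.Properties.Group ℚP.+-0-group as ℚGroup
import Data.Maybe as Maybe
open import Data.Product using (_,_; _×_; proj₁; proj₂; ∃; uncurry)
open import Data.Sum using (_⊎_; inj₁; inj₂; [_,_]′)
open import Level using (0ℓ)
open import Relation.Nullary using (Dec; yes; no; contradiction)
open import Relation.Nullary.Decidable using (dec⇒maybe)
open import Relation.Binary.PropositionalEquality
open import Relation.Binary.Definitions using (tri<; tri≈; tri>)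
open import Algebra.Bundles using (CommutativeRing; RawRing)
open import Tactic.RingSolver using (solve-∀)
import Tactic.RingSolver.Core.AlmostCommutativeRing as TACR
import Algebra.Solver.Ring.AlmostCommutativeRing as ACR
open ACR using (_-Raw-AlmostCommutative⟶_)

ℚ-ring : TACR.AlmostCommutativeRing 0ℓ 0ℓ
ℚ-ring = TACR.fromCommutativeRing ℚP.+-*-commutativeRing
  (λ x → Maybe.map sym (dec⇒maybe (x ℚP.≟ 0ℚ)))

ι : ℤ → ℚ
ι z = z ℚ./ 1

ι≡mkℚ : ∀ z → ι z ≡ mkℚ z 0 (Coprime.sym (Coprime.1-coprimeTo _))
ι≡mkℚ (+ n)    = ℚP.normalize-coprime (Coprime.sym (Coprime.1-coprimeTo n))
ι≡mkℚ -[1+ n ] = cong ℚ.-_ (ℚP.normalize-coprime (Coprime.sym (Coprime.1-coprimeTo (suc n))))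

ι-+ : ∀ x y → ι (x ℤ.+ y) ≡ ι x ℚ.+ ι y
ι-+ x y rewrite ι≡mkℚ x | ι≡mkℚ y =
  cong ι (cong₂ ℤ._+_ (sym (ℤP.*-identityʳ x)) (sym (ℤP.*-identityʳ y)))

ι-* : ∀ x y → ι (x ℤ.* y) ≡ ι x ℚ.* ι y
ι-* x y rewrite ι≡mkℚ x | ι≡mkℚ y = refl

ι-neg : ∀ x → ι (ℤ.- x) ≡ ℚ.- ι x
ι-neg x rewrite ι≡mkℚ x | ι≡mkℚ (ℤ.- x) = mkℚ-neg x
  where
  mkℚ-neg : ∀ x → mkℚ (ℤ.- x) 0 (Coprime.sym (Coprime.1-coprimeTo _)) ≡ ℚ.- mkℚ x 0 (Coprime.sym (Coprime.1-coprimeTo _))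
  mkℚ-neg (+ 0)    = refl
  mkℚ-neg +[1+ n ] = refl
  mkℚ-neg -[1+ n ] = refl

ι-injective : ∀ {x y} → ι x ≡ ι y → x ≡ y
ι-injective {x} {y} eq rewrite ι≡mkℚ x | ι≡mkℚ y = cong ℚ.numerator eq

/2≡*½ : ∀ z → z ℚ./ 2 ≡ ι z ℚ.* ½
/2≡*½ z = ℚP.toℚᵘ-injective (ℚU.≃-trans (ℚP.toℚᵘ-fromℚᵘ (ℚᵘ.mkℚᵘ z 1))
  (ℚU.≃-trans (ℚᵘ.*≡* (cross z)) (ℚU.≃-sym (ℚP.toℚᵘ-homo-* (ι z) ½))))
  where
  cross : ∀ z → z ℤ.* ℚᵘ.↧ (ℚ.toℚᵘ (ι z) ℚᵘ.* ℚ.toℚᵘ ½) ≡ ℚᵘ.↥ (ℚ.toℚᵘ (ι z) ℚᵘ.* ℚ.toℚᵘ ½) ℤ.* + 2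
  cross z rewrite ι≡mkℚ z = cong (ℤ._* + 2) (sym (ℤP.*-identityʳ z))

ι-positive : ∀ {z} → + 0 ℤ.< z → ℚ.Positive (ι z)
ι-positive {z} 0<z rewrite ι≡mkℚ z = ℤ.positive 0<z

positive⇒≢0 : ∀ {p} → ℚ.Positive p → p ≢ 0ℚ
positive⇒≢0 {p} p>0 p≡0 = ℚP.<⇒≢ (ℚP.positive⁻¹ p {{p>0}}) (sym p≡0)

*-cancelˡ-≡ : ∀ {c x y} → c ≢ 0ℚ → c ℚ.* x ≡ c ℚ.* y → x ≡ y
*-cancelˡ-≡ {c} {x} {y} c≢0 cx≡cy = begin
  x                       ≡⟨ x≡c⁻¹[cx] (ℚ.1/ c) c x (ℚP.*-inverseˡ c) ⟩
  ℚ.1/ c ℚ.* (c ℚ.* x)    ≡⟨ cong (ℚ.1/ c ℚ.*_) cx≡cy ⟩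
  ℚ.1/ c ℚ.* (c ℚ.* y)    ≡⟨ sym (x≡c⁻¹[cx] (ℚ.1/ c) c y (ℚP.*-inverseˡ c)) ⟩
  y                       ∎
  where
  open ≡-Reasoning
  instance _ = ℚ.≢-nonZero c≢0
  x≡c⁻¹[cx] : ∀ c⁻¹ c x → c⁻¹ ℚ.* c ≡ 1ℚ → x ≡ c⁻¹ ℚ.* (c ℚ.* x)
  x≡c⁻¹[cx] c⁻¹ c x inv = trans (sym (ℚP.*-identityˡ x))
    (trans (cong (ℚ._* x) (sym inv)) (ℚP.*-assoc c⁻¹ c x))

square-nonNegative : ∀ x → ℚ.NonNegative (x ℚ.* x)
square-nonNegative x with ℚP.≤-total x 0ℚ
... | inj₁ x≤0 = ℚP.nonPos*nonPos⇒nonPos x {{ℚ.nonPositive x≤0}} x {{ℚ.nonPositive x≤0}}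
... | inj₂ 0≤x = ℚP.nonNeg*nonNeg⇒nonNeg x {{ℚ.nonNegative 0≤x}} x {{ℚ.nonNegative 0≤x}}

square-positive : ∀ {x} → x ≢ 0ℚ → ℚ.Positive (x ℚ.* x)
square-positive {x} x≢0 with ℚP.<-cmp x 0ℚ
... | tri< x<0 _ _ = ℚP.neg*neg⇒pos x {{ℚ.negative x<0}} x {{ℚ.negative x<0}}
... | tri≈ _ x≡0 _ = contradiction x≡0 x≢0
... | tri> _ _ x>0 = ℚP.pos*pos⇒pos x {{ℚ.positive x>0}} x {{ℚ.positive x>0}}

ℤ-square-nonNeg : ∀ x → + 0 ℤ.≤ x ℤ.* x
ℤ-square-nonNeg (+ n)    rewrite sym (ℤP.pos-* n n) = ℤ.+≤+ ℕ.z≤n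
ℤ-square-nonNeg -[1+ n ] = ℤ.+≤+ ℕ.z≤n

ℤ-nonNeg-* : ∀ {x y} → + 0 ℤ.≤ x → + 0 ℤ.≤ y → + 0 ℤ.≤ x ℤ.* y
ℤ-nonNeg-* {+ m} {+ n} _ _ rewrite sym (ℤP.pos-* m n) = ℤ.+≤+ ℕ.z≤n

nonNeg-unit : ∀ {x k} → + 0 ℤ.≤ x → x ℤ.* k ≡ + 1 → x ≡ + 1
nonNeg-unit {+ n} {k} _ xk≡1 =
  cong +_ (ℕP.m*n≡1⇒m≡1 n ℤ.∣ k ∣ (trans (sym (ℤP.abs-* (+ n) k)) (cong ℤ.∣_∣ xk≡1)))

even-product : ∀ z → ∃ λ k → z ℤ.* (z ℤ.+ + 1) ≡ + 2 ℤ.* k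
even-product z with z ℤDivMod.%ℕ 2 | ℤDivMod.a≡a%ℕn+[a/ℕn]*n z 2 | ℤDivMod.n%ℕd<d z 2
... | 0 | z≡2h | _ = let h = z ℤDivMod./ℕ 2 in
  h ℤ.* (+ 2 ℤ.* h ℤ.+ + 1) , trans (cong (λ z → z ℤ.* (z ℤ.+ + 1)) z≡2h) (even h)
  where
  even : ∀ h → (+ 0 ℤ.+ h ℤ.* + 2) ℤ.* (+ 0 ℤ.+ h ℤ.* + 2 ℤ.+ + 1) ≡ + 2 ℤ.* (h ℤ.* (+ 2 ℤ.* h ℤ.+ + 1))
  even = solve-∀ ℤ-ring
... | 1 | z≡2h+1 | _ = let h = z ℤDivMod./ℕ 2 in
  (+ 2 ℤ.* h ℤ.+ + 1) ℤ.* (h ℤ.+ + 1) , trans (cong (λ z → z ℤ.* (z ℤ.+ + 1)) z≡2h+1) (odd h)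
  where
  odd : ∀ h → (+ 1 ℤ.+ h ℤ.* + 2) ℤ.* (+ 1 ℤ.+ h ℤ.* + 2 ℤ.+ + 1) ≡ + 2 ℤ.* ((+ 2 ℤ.* h ℤ.+ + 1) ℤ.* (h ℤ.+ + 1))
  odd = solve-∀ ℤ-ring
... | suc (suc _) | _ | ℕ.s≤s (ℕ.s≤s ())

-b-d-even : ∀ {a b c d} → disc (form a b c) ≡ d → ∃ λ m → + 2 ℤ.* m ≡ ℤ.- b ℤ.- d
-b-d-even {a} {b} {c} refl with even-product b
... | k , b[b+1]≡2k = + 2 ℤ.* a ℤ.* c ℤ.- k , (begin
  + 2 ℤ.* (+ 2 ℤ.* a ℤ.* c ℤ.- k)                 ≡⟨ distribute a c k ⟩
  + 4 ℤ.* a ℤ.* c ℤ.- + 2 ℤ.* k                    ≡⟨ cong (λ t → + 4 ℤ.* a ℤ.* c ℤ.- t) (sym b[b+1]≡2k) ⟩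
  + 4 ℤ.* a ℤ.* c ℤ.- b ℤ.* (b ℤ.+ + 1)            ≡⟨ regroup a b c ⟩
  ℤ.- b ℤ.- (b ℤ.* b ℤ.- + 4 ℤ.* a ℤ.* c)          ∎)
  where
  open ≡-Reasoning
  distribute : ∀ a c k → + 2 ℤ.* (+ 2 ℤ.* a ℤ.* c ℤ.- k) ≡ + 4 ℤ.* a ℤ.* c ℤ.- + 2 ℤ.* k
  distribute = solve-∀ ℤ-ring
  regroup : ∀ a b c → + 4 ℤ.* a ℤ.* c ℤ.- b ℤ.* (b ℤ.+ + 1) ≡ ℤ.- b ℤ.- (b ℤ.* b ℤ.- + 4 ℤ.* a ℤ.* c)
  regroup = solve-∀ ℤ-ring

4∣d²-d : ∀ {d} → Fundamental d → ∃ λ e → + 4 ℤ.* e ≡ d ℤ.* d ℤ.- d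
4∣d²-d {d} (inj₁ (d≡1[4] , _)) with ℤDivisibility.∣ᵤ⇒∣ d≡1[4]
... | ℤDivisibility.divides k d-1≡4k = d ℤ.* k , (begin
  + 4 ℤ.* (d ℤ.* k)         ≡⟨ reassociate d k ⟩
  d ℤ.* (k ℤ.* + 4)         ≡⟨ cong (d ℤ.*_) (sym d-1≡4k) ⟩
  d ℤ.* (d ℤ.- + 1)         ≡⟨ expand d ⟩
  d ℤ.* d ℤ.- d             ∎)
  where
  open ≡-Reasoning
  reassociate : ∀ d k → + 4 ℤ.* (d ℤ.* k) ≡ d ℤ.* (k ℤ.* + 4)
  reassociate = solve-∀ ℤ-ring
  expand : ∀ d → d ℤ.* (d ℤ.- + 1) ≡ d ℤ.* d ℤ.- d
  expand = solve-∀ ℤ-ring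
4∣d²-d {d} (inj₂ (m , d≡4m , _)) = m ℤ.* (d ℤ.- + 1) , (begin
  + 4 ℤ.* (m ℤ.* (d ℤ.- + 1))   ≡⟨ ℤP.*-assoc (+ 4) m (d ℤ.- + 1) ⟨
  + 4 ℤ.* m ℤ.* (d ℤ.- + 1)     ≡⟨ cong (ℤ._* (d ℤ.- + 1)) (sym d≡4m) ⟩
  d ℤ.* (d ℤ.- + 1)             ≡⟨ expand d ⟩
  d ℤ.* d ℤ.- d                 ∎)
  where
  open ≡-Reasoning
  expand : ∀ d → d ℤ.* (d ℤ.- + 1) ≡ d ℤ.* d ℤ.- d
  expand = solve-∀ ℤ-ring

complete-square : ∀ a b c x y → + 4 ℤ.* a ℤ.* evalF (form a b c) x y
  ≡ (+ 2 ℤ.* a ℤ.* x ℤ.+ b ℤ.* y) ℤ.* (+ 2 ℤ.* a ℤ.* x ℤ.+ b ℤ.* y) ℤ.- disc (form a b c) ℤ.* (y ℤ.* y)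
complete-square = identity
  where
  identity : ∀ a b c x y → + 4 ℤ.* a ℤ.* (a ℤ.* x ℤ.* x ℤ.+ b ℤ.* x ℤ.* y ℤ.+ c ℤ.* y ℤ.* y)
    ≡ (+ 2 ℤ.* a ℤ.* x ℤ.+ b ℤ.* y) ℤ.* (+ 2 ℤ.* a ℤ.* x ℤ.+ b ℤ.* y) ℤ.- (b ℤ.* b ℤ.- + 4 ℤ.* a ℤ.* c) ℤ.* (y ℤ.* y)
  identity = solve-∀ ℤ-ring

evalF-nonNeg : ∀ {a b c} → + 0 ℤ.< a → disc (form a b c) ℤ.< + 0 → ∀ x y → + 0 ℤ.≤ evalF (form a b c) x y
evalF-nonNeg {a} {b} {c} 0<a disc<0 x y = ℤP.*-cancelˡ-≤-pos (+ 0) (evalF (form a b c) x y) (+ 4 ℤ.* a)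
  {{ℤ.positive (ℤP.*-monoˡ-<-pos (+ 4) 0<a)}} (begin
  + 4 ℤ.* a ℤ.* + 0                  ≡⟨ ℤP.*-zeroʳ (+ 4 ℤ.* a) ⟩
  + 0                                ≤⟨ ℤP.+-mono-≤ (ℤ-square-nonNeg u)
                                          (ℤ-nonNeg-* (ℤP.<⇒≤ (ℤP.neg-mono-< disc<0)) (ℤ-square-nonNeg y)) ⟩
  u ℤ.* u ℤ.+ ℤ.- D ℤ.* (y ℤ.* y)     ≡⟨ as-sum u D (y ℤ.* y) ⟩
  u ℤ.* u ℤ.- D ℤ.* (y ℤ.* y)        ≡⟨ complete-square a b c x y ⟨
  + 4 ℤ.* a ℤ.* evalF (form a b c) x y ∎)
  where
  open ℤP.≤-Reasoning
  u D : ℤ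
  u = + 2 ℤ.* a ℤ.* x ℤ.+ b ℤ.* y
  D = disc (form a b c)
  as-sum : ∀ u D t → u ℤ.* u ℤ.+ ℤ.- D ℤ.* t ≡ u ℤ.* u ℤ.- D ℤ.* t
  as-sum = solve-∀ ℤ-ring

composition-identity : ∀ a b c r s x y →
  ((+ 2 ℤ.* a ℤ.* s ℤ.- b ℤ.* r) ℤ.* x ℤ.+ (b ℤ.* s ℤ.- + 2 ℤ.* c ℤ.* r) ℤ.* y) ℤ.*
  ((+ 2 ℤ.* a ℤ.* s ℤ.- b ℤ.* r) ℤ.* x ℤ.+ (b ℤ.* s ℤ.- + 2 ℤ.* c ℤ.* r) ℤ.* y)
  ℤ.- disc (form a b c) ℤ.* ((r ℤ.* x ℤ.+ s ℤ.* y) ℤ.* (r ℤ.* x ℤ.+ s ℤ.* y))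
  ≡ + 4 ℤ.* evalF (form a b c) s (ℤ.- r) ℤ.* evalF (form a b c) x y
composition-identity = identity
  where
  identity : ∀ a b c r s x y →
    ((+ 2 ℤ.* a ℤ.* s ℤ.- b ℤ.* r) ℤ.* x ℤ.+ (b ℤ.* s ℤ.- + 2 ℤ.* c ℤ.* r) ℤ.* y) ℤ.*
    ((+ 2 ℤ.* a ℤ.* s ℤ.- b ℤ.* r) ℤ.* x ℤ.+ (b ℤ.* s ℤ.- + 2 ℤ.* c ℤ.* r) ℤ.* y)
    ℤ.- (b ℤ.* b ℤ.- + 4 ℤ.* a ℤ.* c) ℤ.* ((r ℤ.* x ℤ.+ s ℤ.* y) ℤ.* (r ℤ.* x ℤ.+ s ℤ.* y))
    ≡ + 4 ℤ.* (a ℤ.* s ℤ.* s ℤ.+ b ℤ.* s ℤ.* ℤ.- r ℤ.+ c ℤ.* ℤ.- r ℤ.* ℤ.- r)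
          ℤ.* (a ℤ.* x ℤ.* x ℤ.+ b ℤ.* x ℤ.* y ℤ.+ c ℤ.* y ℤ.* y)
  identity = solve-∀ ℤ-ring

-- The hypotheses are the relations between σ = (p q ; r s), Q = (a, b, c) and Q' = (a', b', c')
-- provided by ν[ω_Q, 1] = [ω_Q', 1] (see ratio-columns).
module Transformation (a b c a' b' c' p q r s : ℤ)
  (first-column  : + 2 ℤ.* a ℤ.* p ℤ.+ b ℤ.* r ≡ + 2 ℤ.* a' ℤ.* s ℤ.- b' ℤ.* r)
  (second-column : + 2 ℤ.* a ℤ.* q ℤ.+ b ℤ.* s ≡ b' ℤ.* s ℤ.- + 2 ℤ.* c' ℤ.* r) where

  det : ℤ
  det = p ℤ.* s ℤ.- q ℤ.* r

  a·det≡Q'[s,-r] : a ℤ.* det ≡ evalF (form a' b' c') s (ℤ.- r)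
  a·det≡Q'[s,-r] = ℤP.*-cancelˡ-≡ (+ 2) _ _ (begin
    + 2 ℤ.* (a ℤ.* det)                                     ≡⟨ by-columns a b p q r s ⟩
    s ℤ.* (+ 2 ℤ.* a ℤ.* p ℤ.+ b ℤ.* r) ℤ.- r ℤ.* (+ 2 ℤ.* a ℤ.* q ℤ.+ b ℤ.* s)
      ≡⟨ cong₂ (λ u v → s ℤ.* u ℤ.- r ℤ.* v) first-column second-column ⟩
    s ℤ.* (+ 2 ℤ.* a' ℤ.* s ℤ.- b' ℤ.* r) ℤ.- r ℤ.* (b' ℤ.* s ℤ.- + 2 ℤ.* c' ℤ.* r) ≡⟨ collect a' b' c' r s ⟩
    + 2 ℤ.* evalF (form a' b' c') s (ℤ.- r)                 ∎)
    where
    open ≡-Reasoning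
    by-columns : ∀ a b p q r s → + 2 ℤ.* (a ℤ.* (p ℤ.* s ℤ.- q ℤ.* r))
      ≡ s ℤ.* (+ 2 ℤ.* a ℤ.* p ℤ.+ b ℤ.* r) ℤ.- r ℤ.* (+ 2 ℤ.* a ℤ.* q ℤ.+ b ℤ.* s)
    by-columns = solve-∀ ℤ-ring
    collect : ∀ a' b' c' r s → s ℤ.* (+ 2 ℤ.* a' ℤ.* s ℤ.- b' ℤ.* r) ℤ.- r ℤ.* (b' ℤ.* s ℤ.- + 2 ℤ.* c' ℤ.* r)
      ≡ + 2 ℤ.* (a' ℤ.* s ℤ.* s ℤ.+ b' ℤ.* s ℤ.* ℤ.- r ℤ.+ c' ℤ.* ℤ.- r ℤ.* ℤ.- r)
    collect = solve-∀ ℤ-ring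

  -- a·det = Q'(s, -r) ≥ 0, so an invertible det is 1.
  unit-det≡1 : + 0 ℤ.< a → + 0 ℤ.< a' → disc (form a' b' c') ℤ.< + 0 → ∀ {k} → det ℤ.* k ≡ + 1 → det ≡ + 1
  unit-det≡1 0<a 0<a' disc'<0 det·k≡1 = nonNeg-unit
    (ℤP.*-cancelˡ-≤-pos (+ 0) det a {{ℤ.positive 0<a}}
      (subst (ℤ._≤ a ℤ.* det) (sym (ℤP.*-zeroʳ a))
        (subst (+ 0 ℤ.≤_) (sym a·det≡Q'[s,-r]) (evalF-nonNeg {a'} {b'} {c'} 0<a' disc'<0 s (ℤ.- r)))))
    det·k≡1

  transformed-form : + 0 ℤ.< a → disc (form a b c) ≡ disc (form a' b' c') → det ≡ + 1 →
    ∀ x y → evalF (form a' b' c') x y ≡ evalF (form a b c) (p ℤ.* x ℤ.+ q ℤ.* y) (r ℤ.* x ℤ.+ s ℤ.* y)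
  transformed-form 0<a disc≡disc' det≡1 x y = sym (ℤP.*-cancelˡ-≡ (+ 4 ℤ.* a) _ _
    {{ℤ.>-nonZero (ℤP.*-monoˡ-<-pos (+ 4) 0<a)}} (begin
    + 4 ℤ.* a ℤ.* evalF (form a b c) X Y                       ≡⟨ complete-square a b c X Y ⟩
    (+ 2 ℤ.* a ℤ.* X ℤ.+ b ℤ.* Y) ℤ.* (+ 2 ℤ.* a ℤ.* X ℤ.+ b ℤ.* Y) ℤ.- disc (form a b c) ℤ.* (Y ℤ.* Y)
      ≡⟨ cong₂ (λ u D → u ℤ.* u ℤ.- D ℤ.* (Y ℤ.* Y)) linear-part disc≡disc' ⟩
    L ℤ.* L ℤ.- disc (form a' b' c') ℤ.* (Y ℤ.* Y)              ≡⟨ composition-identity a' b' c' r s x y ⟩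
    + 4 ℤ.* evalF (form a' b' c') s (ℤ.- r) ℤ.* evalF (form a' b' c') x y
      ≡⟨ cong (λ n → + 4 ℤ.* n ℤ.* evalF (form a' b' c') x y) (sym a·det≡Q'[s,-r]) ⟩
    + 4 ℤ.* (a ℤ.* det) ℤ.* evalF (form a' b' c') x y
      ≡⟨ cong (λ δ → + 4 ℤ.* (a ℤ.* δ) ℤ.* evalF (form a' b' c') x y) det≡1 ⟩
    + 4 ℤ.* (a ℤ.* + 1) ℤ.* evalF (form a' b' c') x y            ≡⟨ cong (λ t → + 4 ℤ.* t ℤ.* _) (ℤP.*-identityʳ a) ⟩
    + 4 ℤ.* a ℤ.* evalF (form a' b' c') x y                      ∎))
    where
    open ≡-Reasoning
    X Y L : ℤ
    X = p ℤ.* x ℤ.+ q ℤ.* y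
    Y = r ℤ.* x ℤ.+ s ℤ.* y
    L = (+ 2 ℤ.* a' ℤ.* s ℤ.- b' ℤ.* r) ℤ.* x ℤ.+ (b' ℤ.* s ℤ.- + 2 ℤ.* c' ℤ.* r) ℤ.* y
    by-columns : ∀ a b p q r s x y → + 2 ℤ.* a ℤ.* (p ℤ.* x ℤ.+ q ℤ.* y) ℤ.+ b ℤ.* (r ℤ.* x ℤ.+ s ℤ.* y)
      ≡ (+ 2 ℤ.* a ℤ.* p ℤ.+ b ℤ.* r) ℤ.* x ℤ.+ (+ 2 ℤ.* a ℤ.* q ℤ.+ b ℤ.* s) ℤ.* y
    by-columns = solve-∀ ℤ-ring
    linear-part : + 2 ℤ.* a ℤ.* X ℤ.+ b ℤ.* Y ≡ L
    linear-part = trans (by-columns a b p q r s x y)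
      (cong₂ (λ u v → u ℤ.* x ℤ.+ v ℤ.* y) first-column second-column)

ratio-columns : ∀ {a b a' b' c' p q r s} → + 0 ℤ.< a' →
  a' ℤ.* (+ 2 ℤ.* a ℤ.* q) ≡ a' ℤ.* s ℤ.* (b' ℤ.- b) ℤ.- c' ℤ.* r ℤ.* (+ 2 ℤ.* a')
  × a' ℤ.* (+ 2 ℤ.* a ℤ.* p) ≡ a' ℤ.* (s ℤ.* (+ 2 ℤ.* a') ℤ.+ r ℤ.* (b' ℤ.- b)) ℤ.- b' ℤ.* r ℤ.* (+ 2 ℤ.* a') →
  (+ 2 ℤ.* a ℤ.* p ℤ.+ b ℤ.* r ≡ + 2 ℤ.* a' ℤ.* s ℤ.- b' ℤ.* r)
  × (+ 2 ℤ.* a ℤ.* q ℤ.+ b ℤ.* s ≡ b' ℤ.* s ℤ.- + 2 ℤ.* c' ℤ.* r)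
ratio-columns {a} {b} {a'} {b'} {c'} {p} {q} {r} {s} 0<a' (q-coefficient , p-coefficient) =
    ℤP.*-cancelˡ-≡ a' _ _ (begin
      a' ℤ.* (+ 2 ℤ.* a ℤ.* p ℤ.+ b ℤ.* r)   ≡⟨ distribute a' (+ 2 ℤ.* a ℤ.* p) (b ℤ.* r) ⟩
      a' ℤ.* (+ 2 ℤ.* a ℤ.* p) ℤ.+ a' ℤ.* (b ℤ.* r)
        ≡⟨ cong (ℤ._+ a' ℤ.* (b ℤ.* r)) p-coefficient ⟩
      a' ℤ.* (s ℤ.* (+ 2 ℤ.* a') ℤ.+ r ℤ.* (b' ℤ.- b)) ℤ.- b' ℤ.* r ℤ.* (+ 2 ℤ.* a') ℤ.+ a' ℤ.* (b ℤ.* r)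
        ≡⟨ first a' b b' r s ⟩
      a' ℤ.* (+ 2 ℤ.* a' ℤ.* s ℤ.- b' ℤ.* r) ∎)
  , ℤP.*-cancelˡ-≡ a' _ _ (begin
      a' ℤ.* (+ 2 ℤ.* a ℤ.* q ℤ.+ b ℤ.* s)   ≡⟨ distribute a' (+ 2 ℤ.* a ℤ.* q) (b ℤ.* s) ⟩
      a' ℤ.* (+ 2 ℤ.* a ℤ.* q) ℤ.+ a' ℤ.* (b ℤ.* s)
        ≡⟨ cong (ℤ._+ a' ℤ.* (b ℤ.* s)) q-coefficient ⟩
      a' ℤ.* s ℤ.* (b' ℤ.- b) ℤ.- c' ℤ.* r ℤ.* (+ 2 ℤ.* a') ℤ.+ a' ℤ.* (b ℤ.* s)
        ≡⟨ second a' b b' c' r s ⟩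
      a' ℤ.* (b' ℤ.* s ℤ.- + 2 ℤ.* c' ℤ.* r) ∎)
  where
  open ≡-Reasoning
  instance _ = ℤ.>-nonZero 0<a'
  distribute : ∀ k x y → k ℤ.* (x ℤ.+ y) ≡ k ℤ.* x ℤ.+ k ℤ.* y
  distribute = solve-∀ ℤ-ring
  first : ∀ a' b b' r s → a' ℤ.* (s ℤ.* (+ 2 ℤ.* a') ℤ.+ r ℤ.* (b' ℤ.- b)) ℤ.- b' ℤ.* r ℤ.* (+ 2 ℤ.* a') ℤ.+ a' ℤ.* (b ℤ.* r)
    ≡ a' ℤ.* (+ 2 ℤ.* a' ℤ.* s ℤ.- b' ℤ.* r)
  first = solve-∀ ℤ-ring
  second : ∀ a' b b' c' r s → a' ℤ.* s ℤ.* (b' ℤ.- b) ℤ.- c' ℤ.* r ℤ.* (+ 2 ℤ.* a') ℤ.+ a' ℤ.* (b ℤ.* s)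
    ≡ a' ℤ.* (b' ℤ.* s ℤ.- + 2 ℤ.* c' ℤ.* r)
  second = solve-∀ ℤ-ring

N∣r∧N∣a'[s-1] : ∀ {N a' m' r s κ₁ κ₂} → a' ℤ.* (s ℤ.- + 1) ℤ.+ r ℤ.* m' ≡ + N ℤ.* κ₁ → r ℤ.* + 1 ≡ + N ℤ.* κ₂ →
  + N ℤDivisibility.∣ r × + N ℤDivisibility.∣ a' ℤ.* (s ℤ.- + 1)
N∣r∧N∣a'[s-1] {N} {a'} {m'} {r} {s} {κ₁} {κ₂} first second =
    ℤDivisibility.divides κ₂ (trans (sym (ℤP.*-identityʳ r)) (trans second (ℤP.*-comm (+ N) κ₂)))
  , ℤDivisibility.divides (κ₁ ℤ.- κ₂ ℤ.* m') (begin
      a' ℤ.* (s ℤ.- + 1)                              ≡⟨ isolate (a' ℤ.* (s ℤ.- + 1)) r m' ⟩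
      (a' ℤ.* (s ℤ.- + 1) ℤ.+ r ℤ.* m') ℤ.- r ℤ.* + 1 ℤ.* m'
        ≡⟨ cong₂ (λ u v → u ℤ.- v ℤ.* m') first second ⟩
      + N ℤ.* κ₁ ℤ.- + N ℤ.* κ₂ ℤ.* m'              ≡⟨ factor (+ N) κ₁ κ₂ m' ⟩
      (κ₁ ℤ.- κ₂ ℤ.* m') ℤ.* + N                     ∎)
  where
  open ≡-Reasoning
  isolate : ∀ x r m' → x ≡ (x ℤ.+ r ℤ.* m') ℤ.- r ℤ.* + 1 ℤ.* m'
  isolate = solve-∀ ℤ-ring
  factor : ∀ n k₁ k₂ m → n ℤ.* k₁ ℤ.- n ℤ.* k₂ ℤ.* m ≡ (k₁ ℤ.- k₂ ℤ.* m) ℤ.* n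
  factor = solve-∀ ℤ-ring

Γ₁-congruences : ∀ {N a' p q r s} → ℕGCD.gcd N ℤ.∣ a' ∣ ≡ 1 → p ℤ.* s ℤ.- q ℤ.* r ≡ + 1 →
  + N ℤDivisibility.∣ r → + N ℤDivisibility.∣ a' ℤ.* (s ℤ.- + 1) →
  p ≡ + 1 [mod N ] × r ≡ + 0 [mod N ] × s ≡ + 1 [mod N ]
Γ₁-congruences {N} {a'} {p} {q} {r} {s} gcd≡1 det≡1 N∣r N∣a'[s-1] =
    ℤDivisibility.∣⇒∣ᵤ (subst (+ N ℤDivisibility.∣_) (sym p-1≡) (ℤDivisibility.∣m∣n⇒∣m-n
      (ℤDivisibility.∣n⇒∣m*n q N∣r) (ℤDivisibility.∣n⇒∣m*n p (ℤDivisibility.∣ᵤ⇒∣ s≡1))))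
  , ℤDivisibility.∣⇒∣ᵤ (subst (+ N ℤDivisibility.∣_) (sym (ℤP.+-identityʳ r)) N∣r)
  , s≡1
  where
  s≡1 : s ≡ + 1 [mod N ]
  s≡1 = Coprime.coprime-divisor (Coprime.gcd≡1⇒coprime gcd≡1)
    (subst (N ℕDivisibility.∣_) (ℤP.abs-* a' (s ℤ.- + 1)) (ℤDivisibility.∣⇒∣ᵤ N∣a'[s-1]))
  p-1≡ : p ℤ.- + 1 ≡ q ℤ.* r ℤ.- p ℤ.* (s ℤ.- + 1)
  p-1≡ = begin
    p ℤ.- + 1                                              ≡⟨ split p q r s ⟩
    q ℤ.* r ℤ.- p ℤ.* (s ℤ.- + 1) ℤ.+ (p ℤ.* s ℤ.- q ℤ.* r ℤ.- + 1)
      ≡⟨ cong (λ t → q ℤ.* r ℤ.- p ℤ.* (s ℤ.- + 1) ℤ.+ (t ℤ.- + 1)) det≡1 ⟩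
    q ℤ.* r ℤ.- p ℤ.* (s ℤ.- + 1) ℤ.+ + 0                  ≡⟨ ℤP.+-identityʳ _ ⟩
    q ℤ.* r ℤ.- p ℤ.* (s ℤ.- + 1)                          ∎
    where
    open ≡-Reasoning
    split : ∀ p q r s → p ℤ.- + 1 ≡ q ℤ.* r ℤ.- p ℤ.* (s ℤ.- + 1) ℤ.+ (p ℤ.* s ℤ.- q ℤ.* r ℤ.- + 1)
    split = solve-∀ ℤ-ring

ℤ-rawRing : RawRing 0ℓ 0ℓ
ℤ-rawRing = CommutativeRing.rawRing ℤP.+-*-commutativeRing

module QuadraticField (d : ℤ) where
  open Field d

  K-≡ : ∀ {x y x' y'} → x ≡ x' → y ≡ y' → x + y √d ≡ x' + y' √d
  K-≡ = cong₂ _+_√d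

  ⊕-assoc : ∀ u v w → (u ⊕ v) ⊕ w ≡ u ⊕ (v ⊕ w)
  ⊕-assoc (a + b √d) (c + e √d) (f + g √d) = K-≡ (ℚP.+-assoc a c f) (ℚP.+-assoc b e g)

  ⊕-comm : ∀ u v → u ⊕ v ≡ v ⊕ u
  ⊕-comm (a + b √d) (c + e √d) = K-≡ (ℚP.+-comm a c) (ℚP.+-comm b e)

  ⊕-identityˡ : ∀ u → 0K ⊕ u ≡ u
  ⊕-identityˡ (a + b √d) = K-≡ (ℚP.+-identityˡ a) (ℚP.+-identityˡ b)

  ⊝-inverseˡ : ∀ u → (⊝ u) ⊕ u ≡ 0K
  ⊝-inverseˡ (a + b √d) = K-≡ (ℚP.+-inverseˡ a) (ℚP.+-inverseˡ b)

  ⊗-assoc : ∀ u v w → (u ⊗ v) ⊗ w ≡ u ⊗ (v ⊗ w)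
  ⊗-assoc (a + b √d) (c + e √d) (f + g √d) = K-≡ (real-part dℚ a b c e f g) (sqrt-part dℚ a b c e f g)
    where
    real-part : ∀ D a b c e f g → (a ℚ.* c ℚ.+ D ℚ.* b ℚ.* e) ℚ.* f ℚ.+ D ℚ.* (a ℚ.* e ℚ.+ b ℚ.* c) ℚ.* g
                         ≡ a ℚ.* (c ℚ.* f ℚ.+ D ℚ.* e ℚ.* g) ℚ.+ D ℚ.* b ℚ.* (c ℚ.* g ℚ.+ e ℚ.* f)
    real-part = solve-∀ ℚ-ring
    sqrt-part : ∀ D a b c e f g → (a ℚ.* c ℚ.+ D ℚ.* b ℚ.* e) ℚ.* g ℚ.+ (a ℚ.* e ℚ.+ b ℚ.* c) ℚ.* f
                         ≡ a ℚ.* (c ℚ.* g ℚ.+ e ℚ.* f) ℚ.+ b ℚ.* (c ℚ.* f ℚ.+ D ℚ.* e ℚ.* g)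
    sqrt-part = solve-∀ ℚ-ring

  ⊗-comm : ∀ u v → u ⊗ v ≡ v ⊗ u
  ⊗-comm (a + b √d) (c + e √d) = K-≡ (real-part dℚ a b c e) (sqrt-part a b c e)
    where
    real-part : ∀ D a b c e → a ℚ.* c ℚ.+ D ℚ.* b ℚ.* e ≡ c ℚ.* a ℚ.+ D ℚ.* e ℚ.* b
    real-part = solve-∀ ℚ-ring
    sqrt-part : ∀ a b c e → a ℚ.* e ℚ.+ b ℚ.* c ≡ c ℚ.* b ℚ.+ e ℚ.* a
    sqrt-part = solve-∀ ℚ-ring

  ⊗-identityˡ : ∀ u → 1K ⊗ u ≡ u
  ⊗-identityˡ (a + b √d) = K-≡ (real-part dℚ a b) (sqrt-part a b)
    where
    real-part : ∀ D a b → 1ℚ ℚ.* a ℚ.+ D ℚ.* 0ℚ ℚ.* b ≡ a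
    real-part = solve-∀ ℚ-ring
    sqrt-part : ∀ a b → 1ℚ ℚ.* b ℚ.+ 0ℚ ℚ.* a ≡ b
    sqrt-part = solve-∀ ℚ-ring

  ⊗-identityʳ : ∀ u → u ⊗ 1K ≡ u
  ⊗-identityʳ u = trans (⊗-comm u 1K) (⊗-identityˡ u)

  ⊗-distribʳ-⊕ : ∀ w u v → (u ⊕ v) ⊗ w ≡ (u ⊗ w) ⊕ (v ⊗ w)
  ⊗-distribʳ-⊕ (f + g √d) (a + b √d) (c + e √d) = K-≡ (real-part dℚ a b c e f g) (sqrt-part a b c e f g)
    where
    real-part : ∀ D a b c e f g → (a ℚ.+ c) ℚ.* f ℚ.+ D ℚ.* (b ℚ.+ e) ℚ.* g
                         ≡ (a ℚ.* f ℚ.+ D ℚ.* b ℚ.* g) ℚ.+ (c ℚ.* f ℚ.+ D ℚ.* e ℚ.* g)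
    real-part = solve-∀ ℚ-ring
    sqrt-part : ∀ a b c e f g → (a ℚ.+ c) ℚ.* g ℚ.+ (b ℚ.+ e) ℚ.* f ≡ (a ℚ.* g ℚ.+ b ℚ.* f) ℚ.+ (c ℚ.* g ℚ.+ e ℚ.* f)
    sqrt-part = solve-∀ ℚ-ring

  +-*-commutativeRing : CommutativeRing 0ℓ 0ℓ
  +-*-commutativeRing = record
    { isCommutativeRing = record
      { isRing = record
        { +-isAbelianGroup = record
          { isGroup = record
            { isMonoid = record
              { isSemigroup = record
                { isMagma = record { isEquivalence = isEquivalence ; ∙-cong = cong₂ _⊕_ }
                ; assoc = ⊕-assoc }
              ; identity = ⊕-identityˡ , λ u → trans (⊕-comm u 0K) (⊕-identityˡ u) }
            ; inverse = ⊝-inverseˡ , λ u → trans (⊕-comm u (⊝ u)) (⊝-inverseˡ u)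
            ; ⁻¹-cong = cong ⊝_ }
          ; comm = ⊕-comm }
        ; *-cong = cong₂ _⊗_
        ; *-assoc = ⊗-assoc
        ; *-identity = ⊗-identityˡ , ⊗-identityʳ
        ; distrib = (λ w u v → trans (⊗-comm w (u ⊕ v))
                                 (trans (⊗-distribʳ-⊕ w u v) (cong₂ _⊕_ (⊗-comm u w) (⊗-comm v w))))
                  , ⊗-distribʳ-⊕ }
      ; *-comm = ⊗-comm } }

  _≟_ : (u v : K) → Dec (u ≡ v)
  (a + b √d) ≟ (c + e √d) with a ℚP.≟ c | b ℚP.≟ e
  ... | yes a≡c   | yes b≡e  = yes (K-≡ a≡c b≡e)
  ... | no a≢c   | _        = no λ eq → a≢c (cong re eq)
  ... | _        | no b≢e   = no λ eq → b≢e (cong sq eq)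


  fromℤ-+ : ∀ x y → fromℤ (x ℤ.+ y) ≡ fromℤ x ⊕ fromℤ y
  fromℤ-+ x y = K-≡ (ι-+ x y) (sym (ℚP.+-identityˡ 0ℚ))

  fromℤ-* : ∀ x y → fromℤ (x ℤ.* y) ≡ fromℤ x ⊗ fromℤ y
  fromℤ-* x y = K-≡ (trans (ι-* x y) (real-part dℚ (ι x) (ι y))) (sqrt-part (ι x) (ι y))
    where
    real-part : ∀ D x y → x ℚ.* y ≡ x ℚ.* y ℚ.+ D ℚ.* 0ℚ ℚ.* 0ℚ
    real-part = solve-∀ ℚ-ring
    sqrt-part : ∀ x y → 0ℚ ≡ x ℚ.* 0ℚ ℚ.+ 0ℚ ℚ.* y
    sqrt-part = solve-∀ ℚ-ring

  fromℤ-neg : ∀ x → fromℤ (ℤ.- x) ≡ ⊝ fromℤ x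
  fromℤ-neg x = K-≡ (ι-neg x) refl

  fromℤ-- : ∀ x y → fromℤ (x ℤ.- y) ≡ fromℤ x ⊖ fromℤ y
  fromℤ-- x y = trans (fromℤ-+ x (ℤ.- y)) (cong (fromℤ x ⊕_) (fromℤ-neg y))

  fromℤ-*³ : ∀ x y z → fromℤ (x ℤ.* y ℤ.* z) ≡ fromℤ x ⊗ fromℤ y ⊗ fromℤ z
  fromℤ-*³ x y z = trans (fromℤ-* (x ℤ.* y) z) (cong (_⊗ fromℤ z) (fromℤ-* x y))

  fromℤ-homomorphism : ℤ-rawRing -Raw-AlmostCommutative⟶ ACR.fromCommutativeRing +-*-commutativeRing
  fromℤ-homomorphism = record
    { ⟦_⟧ = fromℤ ; +-homo = fromℤ-+ ; *-homo = fromℤ-* ; -‿homo = fromℤ-neg ; 0-homo = refl ; 1-homo = refl }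

  open import Algebra.Solver.Ring ℤ-rawRing (ACR.fromCommutativeRing +-*-commutativeRing) fromℤ-homomorphism
    (λ m n → Maybe.map (cong fromℤ) (dec⇒maybe (m ℤ.≟ n)))


  ⊗-cancelˡ : d ℤ.< + 0 → ∀ {B u v} → B ≢ 0K → B ⊗ u ≡ B ⊗ v → u ≡ v
  ⊗-cancelˡ d<0 {B} {u₁ + u₂ √d} {v₁ + v₂ √d} B≢0 Bu≡Bv =
    K-≡ (*-cancelˡ-≡ N≢0 (cong re conj-eq)) (*-cancelˡ-≡ N≢0 (cong sq conj-eq))
    where
    norm : K → ℚ
    norm (x + y √d) = x ℚ.* x ℚ.- dℚ ℚ.* y ℚ.* y

    0<-d : ℚ.Positive (ℚ.- dℚ)
    0<-d = subst ℚ.Positive (ι-neg d) (ι-positive (ℤP.neg-mono-< d<0))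

    N≢0 : norm B ≢ 0ℚ
    N≢0 = positive⇒≢0 (norm-positive B B≢0)
      where
      norm-positive : ∀ B → B ≢ 0K → ℚ.Positive (norm B)
      norm-positive (x + y √d) B≢0 with y ℚP.≟ 0ℚ
      ... | no y≢0 = subst ℚ.Positive (sym (split x y dℚ))
            (ℚP.nonNeg+pos⇒pos (x ℚ.* x) {{square-nonNegative x}}
              (ℚ.- dℚ ℚ.* (y ℚ.* y)) {{ℚP.pos*pos⇒pos (ℚ.- dℚ) {{0<-d}} (y ℚ.* y) {{square-positive y≢0}}}})
        where
        split : ∀ x y D → x ℚ.* x ℚ.- D ℚ.* y ℚ.* y ≡ x ℚ.* x ℚ.+ ℚ.- D ℚ.* (y ℚ.* y)
        split = solve-∀ ℚ-ring
      ... | yes refl = subst ℚ.Positive (sym (drop x dℚ)) (square-positive λ x≡0 → B≢0 (cong (_+ 0ℚ √d) x≡0))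
        where
        drop : ∀ x D → x ℚ.* x ℚ.- D ℚ.* 0ℚ ℚ.* 0ℚ ≡ x ℚ.* x
        drop = solve-∀ ℚ-ring

    conj : K → K
    conj (x + y √d) = x + (ℚ.- y) √d

    conj-⊗-⊗ : ∀ B u₁ u₂ → conj B ⊗ (B ⊗ (u₁ + u₂ √d)) ≡ (norm B ℚ.* u₁) + (norm B ℚ.* u₂) √d
    conj-⊗-⊗ (x + y √d) u₁ u₂ = K-≡ (real-part dℚ x y u₁ u₂) (sqrt-part dℚ x y u₁ u₂)
      where
      real-part : ∀ D x y u₁ u₂ → x ℚ.* (x ℚ.* u₁ ℚ.+ D ℚ.* y ℚ.* u₂) ℚ.+ D ℚ.* ℚ.- y ℚ.* (x ℚ.* u₂ ℚ.+ y ℚ.* u₁)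
                                  ≡ (x ℚ.* x ℚ.- D ℚ.* y ℚ.* y) ℚ.* u₁
      real-part = solve-∀ ℚ-ring
      sqrt-part : ∀ D x y u₁ u₂ → x ℚ.* (x ℚ.* u₂ ℚ.+ y ℚ.* u₁) ℚ.+ ℚ.- y ℚ.* (x ℚ.* u₁ ℚ.+ D ℚ.* y ℚ.* u₂)
                                  ≡ (x ℚ.* x ℚ.- D ℚ.* y ℚ.* y) ℚ.* u₂
      sqrt-part = solve-∀ ℚ-ring

    conj-eq : (norm B ℚ.* u₁) + (norm B ℚ.* u₂) √d ≡ (norm B ℚ.* v₁) + (norm B ℚ.* v₂) √d
    conj-eq = trans (sym (conj-⊗-⊗ B u₁ u₂)) (trans (cong (conj B ⊗_) Bu≡Bv) (conj-⊗-⊗ B v₁ v₂))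

  comb : K → ℤ → ℤ → K
  comb ω m n = fromℤ m ⊕ n · ω

  IsRoot : Form → K → Set
  IsRoot (form A B C) ω = fromℤ A ⊗ ω ⊗ ω ⊕ fromℤ B ⊗ ω ⊕ fromℤ C ≡ 0K

  comb-+ : ∀ ω m n m' n' → comb ω m n ⊕ comb ω m' n' ≡ comb ω (m ℤ.+ m') (n ℤ.+ n')
  comb-+ ω m n m' n' = trans
    (solve 5 (λ M N M' N' W → (M :+ N :* W) :+ (M' :+ N' :* W) := (M :+ M') :+ (N :+ N') :* W) refl
      (fromℤ m) (fromℤ n) (fromℤ m') (fromℤ n') ω)
    (sym (cong₂ (λ x y → x ⊕ y ⊗ ω) (fromℤ-+ m m') (fromℤ-+ n n')))

  comb-scale : ∀ ω k m n → fromℤ k ⊗ comb ω m n ≡ comb ω (k ℤ.* m) (k ℤ.* n)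
  comb-scale ω k m n = trans
    (solve 4 (λ K M N W → K :* (M :+ N :* W) := K :* M :+ K :* N :* W) refl (fromℤ k) (fromℤ m) (fromℤ n) ω)
    (sym (cong₂ (λ x y → x ⊕ y ⊗ ω) (fromℤ-* k m) (fromℤ-* k n)))

  comb-* : ∀ {A B C ω} → IsRoot (form A B C) ω → ∀ m n m' n' →
    fromℤ A ⊗ (comb ω m n ⊗ comb ω m' n')
      ≡ comb ω (A ℤ.* m ℤ.* m' ℤ.- C ℤ.* n ℤ.* n') (A ℤ.* (m ℤ.* n' ℤ.+ n ℤ.* m') ℤ.- B ℤ.* n ℤ.* n')
  comb-* {A} {B} {C} {ω} root m n m' n' = begin
    Â ⊗ ((M ⊕ N ⊗ ω) ⊗ (M' ⊕ N' ⊗ ω))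
      ≡⟨ solve 8 (λ A B C M N M' N' W →
           A :* ((M :+ N :* W) :* (M' :+ N' :* W))
             := (A :* M :* M' :- C :* N :* N') :+ (A :* (M :* N' :+ N :* M') :- B :* N :* N') :* W
                :+ N :* N' :* (A :* W :* W :+ B :* W :+ C)) refl Â B̂ Ĉ M N M' N' ω ⟩
    (Â ⊗ M ⊗ M' ⊖ Ĉ ⊗ N ⊗ N') ⊕ (Â ⊗ (M ⊗ N' ⊕ N ⊗ M') ⊖ B̂ ⊗ N ⊗ N') ⊗ ω ⊕ N ⊗ N' ⊗ (Â ⊗ ω ⊗ ω ⊕ B̂ ⊗ ω ⊕ Ĉ)
      ≡⟨ cong (λ z → (Â ⊗ M ⊗ M' ⊖ Ĉ ⊗ N ⊗ N') ⊕ (Â ⊗ (M ⊗ N' ⊕ N ⊗ M') ⊖ B̂ ⊗ N ⊗ N') ⊗ ω ⊕ N ⊗ N' ⊗ z) root ⟩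
    (Â ⊗ M ⊗ M' ⊖ Ĉ ⊗ N ⊗ N') ⊕ (Â ⊗ (M ⊗ N' ⊕ N ⊗ M') ⊖ B̂ ⊗ N ⊗ N') ⊗ ω ⊕ N ⊗ N' ⊗ 0K
      ≡⟨ solve 3 (λ x y z → x :+ y :* con (+ 0) := x) refl _ (N ⊗ N') ω ⟩
    (Â ⊗ M ⊗ M' ⊖ Ĉ ⊗ N ⊗ N') ⊕ (Â ⊗ (M ⊗ N' ⊕ N ⊗ M') ⊖ B̂ ⊗ N ⊗ N') ⊗ ω
      ≡⟨ sym (cong₂ (λ x y → x ⊕ y ⊗ ω) constant-coefficient ω-coefficient) ⟩
    comb ω (A ℤ.* m ℤ.* m' ℤ.- C ℤ.* n ℤ.* n') (A ℤ.* (m ℤ.* n' ℤ.+ n ℤ.* m') ℤ.- B ℤ.* n ℤ.* n') ∎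
    where
    open ≡-Reasoning
    Â B̂ Ĉ M N M' N' : K
    Â = fromℤ A; B̂ = fromℤ B; Ĉ = fromℤ C
    M = fromℤ m; N = fromℤ n; M' = fromℤ m'; N' = fromℤ n'
    constant-coefficient : fromℤ (A ℤ.* m ℤ.* m' ℤ.- C ℤ.* n ℤ.* n') ≡ Â ⊗ M ⊗ M' ⊖ Ĉ ⊗ N ⊗ N'
    constant-coefficient = trans (fromℤ-- (A ℤ.* m ℤ.* m') (C ℤ.* n ℤ.* n')) (cong₂ _⊖_ (fromℤ-*³ A m m') (fromℤ-*³ C n n'))
    ω-coefficient : fromℤ (A ℤ.* (m ℤ.* n' ℤ.+ n ℤ.* m') ℤ.- B ℤ.* n ℤ.* n') ≡ Â ⊗ (M ⊗ N' ⊕ N ⊗ M') ⊖ B̂ ⊗ N ⊗ N'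
    ω-coefficient = trans (fromℤ-- (A ℤ.* (m ℤ.* n' ℤ.+ n ℤ.* m')) (B ℤ.* n ℤ.* n')) (cong₂ _⊖_
      (trans (fromℤ-* A (m ℤ.* n' ℤ.+ n ℤ.* m'))
        (cong (Â ⊗_) (trans (fromℤ-+ (m ℤ.* n') (n ℤ.* m')) (cong₂ _⊕_ (fromℤ-* m n') (fromℤ-* n m')))))
      (fromℤ-*³ B n n'))

  comb-injective : ∀ {ω m n m' n'} → sq ω ≢ 0ℚ → comb ω m n ≡ comb ω m' n' → m ≡ m' × n ≡ n'
  comb-injective {X + Y √d} {m} {n} {m'} {n'} Y≢0 eq = m≡m' , n≡n'
    where
    sqrt-part : ∀ n X Y → 0ℚ ℚ.+ (n ℚ.* Y ℚ.+ 0ℚ ℚ.* X) ≡ Y ℚ.* n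
    sqrt-part = solve-∀ ℚ-ring
    n≡n' : n ≡ n'
    n≡n' = ι-injective (*-cancelˡ-≡ Y≢0
      (trans (sym (sqrt-part (ι n) X Y)) (trans (cong sq eq) (sqrt-part (ι n') X Y))))
    m≡m' : m ≡ m'
    m≡m' = ι-injective (ℚGroup.∙-cancelʳ _ _ _ (cong re (subst (λ k → comb _ m k ≡ comb _ m' n') n≡n' eq)))

  comb-combination : ∀ ω k l m n m' n' →
    k · comb ω m n ⊕ l · comb ω m' n' ≡ comb ω (k ℤ.* m ℤ.+ l ℤ.* m') (k ℤ.* n ℤ.+ l ℤ.* n')
  comb-combination ω k l m n m' n' =
    trans (cong₂ _⊕_ (comb-scale ω k m n) (comb-scale ω l m' n')) (comb-+ ω (k ℤ.* m) (k ℤ.* n) (l ℤ.* m') (l ℤ.* n'))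

  -- Expressing the basis (ω, 1) through (pω + q, rω + s) and back gives mutually inverse matrices.
  det-unit : ∀ {ω p q r s p̃ q̃ r̃ s̃} → sq ω ≢ 0ℚ →
    ω ≡ p̃ · comb ω q p ⊕ q̃ · comb ω s r → 1K ≡ r̃ · comb ω q p ⊕ s̃ · comb ω s r →
    (p ℤ.* s ℤ.- q ℤ.* r) ℤ.* (p̃ ℤ.* s̃ ℤ.- q̃ ℤ.* r̃) ≡ + 1
  det-unit {ω} {p} {q} {r} {s} {p̃} {q̃} {r̃} {s̃} sqω≢0 ω≡ 1≡ = begin
    (p ℤ.* s ℤ.- q ℤ.* r) ℤ.* (p̃ ℤ.* s̃ ℤ.- q̃ ℤ.* r̃)
      ≡⟨ det-product p q r s p̃ q̃ r̃ s̃ ⟩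
    (p̃ ℤ.* p ℤ.+ q̃ ℤ.* r) ℤ.* (r̃ ℤ.* q ℤ.+ s̃ ℤ.* s) ℤ.- (p̃ ℤ.* q ℤ.+ q̃ ℤ.* s) ℤ.* (r̃ ℤ.* p ℤ.+ s̃ ℤ.* r)
      ≡⟨ cong₂ (λ u v → u ℤ.* v ℤ.- (p̃ ℤ.* q ℤ.+ q̃ ℤ.* s) ℤ.* (r̃ ℤ.* p ℤ.+ s̃ ℤ.* r))
           (sym (proj₂ first-row)) (sym (proj₁ second-row)) ⟩
    + 1 ℤ.* + 1 ℤ.- (p̃ ℤ.* q ℤ.+ q̃ ℤ.* s) ℤ.* (r̃ ℤ.* p ℤ.+ s̃ ℤ.* r)
      ≡⟨ cong₂ (λ u v → + 1 ℤ.* + 1 ℤ.- u ℤ.* v) (sym (proj₁ first-row)) (sym (proj₂ second-row)) ⟩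
    + 1 ∎
    where
    open ≡-Reasoning
    det-product : ∀ p q r s p̃ q̃ r̃ s̃ → (p ℤ.* s ℤ.- q ℤ.* r) ℤ.* (p̃ ℤ.* s̃ ℤ.- q̃ ℤ.* r̃)
      ≡ (p̃ ℤ.* p ℤ.+ q̃ ℤ.* r) ℤ.* (r̃ ℤ.* q ℤ.+ s̃ ℤ.* s) ℤ.- (p̃ ℤ.* q ℤ.+ q̃ ℤ.* s) ℤ.* (r̃ ℤ.* p ℤ.+ s̃ ℤ.* r)
    det-product = solve-∀ ℤ-ring
    first-row : + 0 ≡ p̃ ℤ.* q ℤ.+ q̃ ℤ.* s × + 1 ≡ p̃ ℤ.* p ℤ.+ q̃ ℤ.* r
    first-row = comb-injective sqω≢0 (trans (solve 1 (λ W → con (+ 0) :+ con (+ 1) :* W := W) refl ω)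
      (trans ω≡ (comb-combination ω p̃ q̃ q p s r)))
    second-row : + 1 ≡ r̃ ℤ.* q ℤ.+ s̃ ℤ.* s × + 0 ≡ r̃ ℤ.* p ℤ.+ s̃ ℤ.* r
    second-row = comb-injective sqω≢0 (trans (solve 1 (λ W → con (+ 1) :+ con (+ 0) :* W := con (+ 1)) refl ω)
      (trans 1≡ (comb-combination ω r̃ s̃ q p s r)))

  -- Multiplying ν ω = μ by 2a a' and using the quadratic equation of ω' to eliminate ω'²
  -- expresses both sides in the basis (1, ω').
  ratio-coefficients : ∀ {ω ω' a b a' b' c' p q r s} → sq ω' ≢ 0ℚ → IsRoot (form a' b' c') ω' →
    fromℤ (+ 2 ℤ.* a) ⊗ ω ≡ fromℤ (+ 2 ℤ.* a') ⊗ ω' ⊕ fromℤ (b' ℤ.- b) → comb ω' s r ⊗ ω ≡ comb ω' q p →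
    a' ℤ.* (+ 2 ℤ.* a ℤ.* q) ≡ a' ℤ.* s ℤ.* (b' ℤ.- b) ℤ.- c' ℤ.* r ℤ.* (+ 2 ℤ.* a')
    × a' ℤ.* (+ 2 ℤ.* a ℤ.* p) ≡ a' ℤ.* (s ℤ.* (+ 2 ℤ.* a') ℤ.+ r ℤ.* (b' ℤ.- b)) ℤ.- b' ℤ.* r ℤ.* (+ 2 ℤ.* a')
  ratio-coefficients {ω} {ω'} {a} {b} {a'} {b'} {c'} {p} {q} {r} {s} sqω'≢0 root' shift νω≡μ =
    comb-injective {ω'} sqω'≢0 (begin
      comb ω' (a' ℤ.* (+ 2 ℤ.* a ℤ.* q)) (a' ℤ.* (+ 2 ℤ.* a ℤ.* p))
        ≡⟨ sym (trans (cong (A' ⊗_) (comb-scale ω' (+ 2 ℤ.* a) q p)) (comb-scale ω' a' _ _)) ⟩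
      A' ⊗ (2A ⊗ comb ω' q p)                 ≡⟨ cong (λ z → A' ⊗ (2A ⊗ z)) (sym νω≡μ) ⟩
      A' ⊗ (2A ⊗ (ν ⊗ ω))
        ≡⟨ solve 4 (λ A' T N W → A' :* (T :* (N :* W)) := A' :* (N :* (T :* W))) refl A' 2A ν ω ⟩
      A' ⊗ (ν ⊗ (2A ⊗ ω))
        ≡⟨ cong (λ z → A' ⊗ (ν ⊗ z)) (trans shift (⊕-comm (fromℤ (+ 2 ℤ.* a') ⊗ ω') (fromℤ (b' ℤ.- b)))) ⟩
      A' ⊗ (ν ⊗ comb ω' (b' ℤ.- b) (+ 2 ℤ.* a'))
        ≡⟨ comb-* {a'} {b'} {c'} {ω'} root' s r (b' ℤ.- b) (+ 2 ℤ.* a') ⟩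
      comb ω' (a' ℤ.* s ℤ.* (b' ℤ.- b) ℤ.- c' ℤ.* r ℤ.* (+ 2 ℤ.* a'))
              (a' ℤ.* (s ℤ.* (+ 2 ℤ.* a') ℤ.+ r ℤ.* (b' ℤ.- b)) ℤ.- b' ℤ.* r ℤ.* (+ 2 ℤ.* a')) ∎)
    where
    open ≡-Reasoning
    A' 2A ν : K
    A' = fromℤ a'
    2A = fromℤ (+ 2 ℤ.* a)
    ν = comb ω' s r

  δ : K
  δ = 0ℚ + 1ℚ √d

  δ⊗δ≡d : δ ⊗ δ ≡ fromℤ d
  δ⊗δ≡d = K-≡ (real-part dℚ) (sqrt-part)
    where
    real-part : ∀ D → 0ℚ ℚ.* 0ℚ ℚ.+ D ℚ.* 1ℚ ℚ.* 1ℚ ≡ D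
    real-part = solve-∀ ℚ-ring
    sqrt-part : 0ℚ ℚ.* 1ℚ ℚ.+ 1ℚ ℚ.* 0ℚ ≡ 0ℚ
    sqrt-part = refl

  2θ≡d+δ : fromℤ (+ 2) ⊗ θ ≡ fromℤ d ⊕ δ
  2θ≡d+δ = K-≡ (trans (cong (λ h → ι (+ 2) ℚ.* h ℚ.+ dℚ ℚ.* 0ℚ ℚ.* ½) (/2≡*½ d)) (real-part dℚ)) (sqrt-part (d ℚ./ 2))
    where
    real-part : ∀ D → ι (+ 2) ℚ.* (D ℚ.* ½) ℚ.+ D ℚ.* 0ℚ ℚ.* ½ ≡ D ℚ.+ 0ℚ
    real-part = solve-∀ ℚ-ring
    sqrt-part : ∀ H → ι (+ 2) ℚ.* ½ ℚ.+ 0ℚ ℚ.* H ≡ 0ℚ ℚ.+ 1ℚ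
    sqrt-part = solve-∀ ℚ-ring

  x⊖y≡0⇒x≡y : ∀ {x y} → x ⊖ y ≡ 0K → x ≡ y
  x⊖y≡0⇒x≡y {x} {y} x-y≡0 = begin
    x              ≡⟨ solve 2 (λ x y → x := (x :- y) :+ y) refl x y ⟩
    (x ⊖ y) ⊕ y    ≡⟨ cong (_⊕ y) x-y≡0 ⟩
    0K ⊕ y         ≡⟨ ⊕-identityˡ y ⟩
    y              ∎
    where open ≡-Reasoning

  fromℤ-⊕-toK : ∀ x m n → fromℤ x ⊕ toK (m , n) ≡ toK (x ℤ.+ m , n)
  fromℤ-⊕-toK x m n = trans (solve 4 (λ X M N Θ → X :+ (M :+ N :* Θ) := (X :+ M) :+ N :* Θ) refl
    (fromℤ x) (fromℤ m) (fromℤ n) θ) (cong (λ t → t ⊕ n · θ) (sym (fromℤ-+ x m)))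

  a'[ν-1]≡ : ∀ {a' m' r s ω'} → fromℤ a' ⊗ ω' ≡ toK (m' , + 1) →
    fromℤ a' ⊗ (comb ω' s r ⊖ 1K) ≡ toK (a' ℤ.* (s ℤ.- + 1) ℤ.+ r ℤ.* m' , r ℤ.* + 1)
  a'[ν-1]≡ {a'} {m'} {r} {s} {ω'} a'ω'≡m'+θ = begin
    A' ⊗ (fromℤ s ⊕ fromℤ r ⊗ ω' ⊖ 1K)
      ≡⟨ solve 4 (λ A' S R W → A' :* (S :+ R :* W :- con (+ 1)) := A' :* (S :- con (+ 1)) :+ R :* (A' :* W))
           refl A' (fromℤ s) (fromℤ r) ω' ⟩
    A' ⊗ (fromℤ s ⊖ 1K) ⊕ fromℤ r ⊗ (A' ⊗ ω')
      ≡⟨ cong₂ _⊕_ (sym (trans (fromℤ-* a' (s ℤ.- + 1)) (cong (A' ⊗_) (fromℤ-- s (+ 1))))) (cong (fromℤ r ⊗_) a'ω'≡m'+θ) ⟩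
    fromℤ (a' ℤ.* (s ℤ.- + 1)) ⊕ fromℤ r ⊗ toK (m' , + 1)
      ≡⟨ cong (fromℤ (a' ℤ.* (s ℤ.- + 1)) ⊕_) (comb-scale θ r m' (+ 1)) ⟩
    fromℤ (a' ℤ.* (s ℤ.- + 1)) ⊕ toK (r ℤ.* m' , r ℤ.* + 1)
      ≡⟨ fromℤ-⊕-toK (a' ℤ.* (s ℤ.- + 1)) (r ℤ.* m') (r ℤ.* + 1) ⟩
    toK (a' ℤ.* (s ℤ.- + 1) ℤ.+ r ℤ.* m' , r ℤ.* + 1) ∎
    where
    open ≡-Reasoning
    A' : K
    A' = fromℤ a'

  -- ν - 1 = (α - β)/β, where β is invertible modulo N and α - β ∈ N𝒪.
  x[ν-1]-multiple-of-N : ∀ {N u v γ A B ν} x → toK u ⊗ B ⊕ toK v ⊗ fromℤ (+ N) ≡ 1K →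
    A ⊖ B ≡ fromℤ (+ N) ⊗ toK γ → A ≡ B ⊗ ν →
    x ⊗ (ν ⊖ 1K) ≡ fromℤ (+ N) ⊗ (toK u ⊗ (x ⊗ toK γ) ⊕ toK v ⊗ (x ⊗ (ν ⊖ 1K)))
  x[ν-1]-multiple-of-N {N} {u} {v} {γ} {A} {B} {ν} x uB+vN≡1 A-B≡Nγ A≡Bν = sym (begin
    Nk ⊗ (U ⊗ (x ⊗ G) ⊕ V ⊗ (x ⊗ (ν ⊖ 1K)))
      ≡⟨ solve 6 (λ Nk U X G V L → Nk :* (U :* (X :* G) :+ V :* (X :* (L :- con (+ 1))))
           := U :* X :* (Nk :* G) :+ V :* Nk :* (X :* (L :- con (+ 1)))) refl Nk U x G V ν ⟩
    U ⊗ x ⊗ (Nk ⊗ G) ⊕ V ⊗ Nk ⊗ (x ⊗ (ν ⊖ 1K))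
      ≡⟨ cong (λ y → U ⊗ x ⊗ y ⊕ V ⊗ Nk ⊗ (x ⊗ (ν ⊖ 1K))) (trans (sym A-B≡Nγ) (cong (_⊖ B) A≡Bν)) ⟩
    U ⊗ x ⊗ (B ⊗ ν ⊖ B) ⊕ V ⊗ Nk ⊗ (x ⊗ (ν ⊖ 1K))
      ≡⟨ solve 6 (λ U X B L V Nk → U :* X :* (B :* L :- B) :+ V :* Nk :* (X :* (L :- con (+ 1)))
           := (U :* B :+ V :* Nk) :* (X :* (L :- con (+ 1)))) refl U x B ν V Nk ⟩
    (U ⊗ B ⊕ V ⊗ Nk) ⊗ (x ⊗ (ν ⊖ 1K))     ≡⟨ cong (_⊗ (x ⊗ (ν ⊖ 1K))) uB+vN≡1 ⟩
    1K ⊗ (x ⊗ (ν ⊖ 1K))                   ≡⟨ ⊗-identityˡ (x ⊗ (ν ⊖ 1K)) ⟩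
    x ⊗ (ν ⊖ 1K)                          ∎)
    where
    open ≡-Reasoning
    Nk U V G : K
    Nk = fromℤ (+ N)
    U = toK u
    V = toK v
    G = toK γ

  module Imaginary (d<0 : d ℤ.< + 0) where

    zero-product : ∀ {x y} → x ⊗ y ≡ 0K → x ≡ 0K ⊎ y ≡ 0K
    zero-product {x} {y} xy≡0 with x ≟ 0K
    ... | yes x≡0 = inj₁ x≡0
    ... | no x≢0  = inj₂ (⊗-cancelˡ d<0 x≢0 (trans xy≡0 (solve 1 (λ x → con (+ 0) := x :* con (+ 0)) refl x)))

    difference-of-squares : ∀ {a b c ω} → disc (form a b c) ≡ d → IsRoot (form a b c) ω →
      (fromℤ (+ 2 ℤ.* a) ⊗ ω ⊕ fromℤ b ⊖ δ) ⊗ (fromℤ (+ 2 ℤ.* a) ⊗ ω ⊕ fromℤ b ⊕ δ) ≡ 0K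
    difference-of-squares {a} {b} {c} {ω} disc≡d root = begin
      (fromℤ (+ 2 ℤ.* a) ⊗ ω ⊕ B ⊖ δ) ⊗ (fromℤ (+ 2 ℤ.* a) ⊗ ω ⊕ B ⊕ δ)
        ≡⟨ cong (λ t → (t ⊗ ω ⊕ B ⊖ δ) ⊗ (t ⊗ ω ⊕ B ⊕ δ)) (fromℤ-* (+ 2) a) ⟩
      (fromℤ (+ 2) ⊗ A ⊗ ω ⊕ B ⊖ δ) ⊗ (fromℤ (+ 2) ⊗ A ⊗ ω ⊕ B ⊕ δ)
        ≡⟨ solve 5 (λ A B C W Δ → (con (+ 2) :* A :* W :+ B :- Δ) :* (con (+ 2) :* A :* W :+ B :+ Δ)
             := con (+ 4) :* A :* (A :* W :* W :+ B :* W :+ C) :+ (B :* B :- con (+ 4) :* A :* C) :- Δ :* Δ)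
             refl A B C ω δ ⟩
      fromℤ (+ 4) ⊗ A ⊗ (A ⊗ ω ⊗ ω ⊕ B ⊗ ω ⊕ C) ⊕ (B ⊗ B ⊖ fromℤ (+ 4) ⊗ A ⊗ C) ⊖ δ ⊗ δ
        ≡⟨ cong₂ (λ t u → fromℤ (+ 4) ⊗ A ⊗ t ⊕ u ⊖ δ ⊗ δ) root disc-in-K ⟩
      fromℤ (+ 4) ⊗ A ⊗ 0K ⊕ fromℤ d ⊖ δ ⊗ δ
        ≡⟨ cong (λ t → fromℤ (+ 4) ⊗ A ⊗ 0K ⊕ fromℤ d ⊖ t) δ⊗δ≡d ⟩
      fromℤ (+ 4) ⊗ A ⊗ 0K ⊕ fromℤ d ⊖ fromℤ d
        ≡⟨ solve 2 (λ A D → con (+ 4) :* A :* con (+ 0) :+ D :- D := con (+ 0)) refl A (fromℤ d) ⟩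
      0K ∎
      where
      open ≡-Reasoning
      A B C : K
      A = fromℤ a; B = fromℤ b; C = fromℤ c
      disc-in-K : B ⊗ B ⊖ fromℤ (+ 4) ⊗ A ⊗ C ≡ fromℤ d
      disc-in-K = trans (sym (trans (fromℤ-- (b ℤ.* b) (+ 4 ℤ.* a ℤ.* c)) (cong₂ _⊖_ (fromℤ-* b b) (fromℤ-*³ (+ 4) a c))))
                        (cong fromℤ disc≡d)

    -- Of the two square roots ±δ of d, 2aω + b is the one of positive imaginary part.
    2aω+b≡δ : ∀ {a b c ω} → + 0 ℤ.< a → disc (form a b c) ≡ d → IsOmega d (form a b c) ω →
              fromℤ (+ 2 ℤ.* a) ⊗ ω ⊕ fromℤ b ≡ δ
    2aω+b≡δ {a} {b} {c} {X + Y √d} 0<a disc≡d (root , 0<Y) =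
      [ x⊖y≡0⇒x≡y , (λ z+δ≡0 → contradiction (cong sq z+δ≡0) (positive⇒≢0 sq-z+δ>0)) ]′
      (zero-product (difference-of-squares {a} {b} {c} {X + Y √d} disc≡d root))
      where
      sqrt-part : ∀ k X Y → (k ℚ.* Y ℚ.+ 0ℚ ℚ.* X) ℚ.+ 0ℚ ℚ.+ 1ℚ ≡ k ℚ.* Y ℚ.+ 1ℚ
      sqrt-part = solve-∀ ℚ-ring
      sq-z+δ>0 : ℚ.Positive (sq (fromℤ (+ 2 ℤ.* a) ⊗ (X + Y √d) ⊕ fromℤ b ⊕ δ))
      sq-z+δ>0 = subst ℚ.Positive (sym (sqrt-part (ι (+ 2 ℤ.* a)) X Y))
        (ℚP.pos+pos⇒pos (ι (+ 2 ℤ.* a) ℚ.* Y)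
          {{ℚP.pos*pos⇒pos (ι (+ 2 ℤ.* a)) {{ι-positive (ℤP.*-monoˡ-<-pos (+ 2) 0<a)}} Y {{ℚ.positive 0<Y}}}} 1ℚ)

    2aω≡2a'ω'+b'-b : ∀ {a b c a' b' c' ω ω'} → + 0 ℤ.< a → disc (form a b c) ≡ d → IsOmega d (form a b c) ω →
      + 0 ℤ.< a' → disc (form a' b' c') ≡ d → IsOmega d (form a' b' c') ω' →
      fromℤ (+ 2 ℤ.* a) ⊗ ω ≡ fromℤ (+ 2 ℤ.* a') ⊗ ω' ⊕ fromℤ (b' ℤ.- b)
    2aω≡2a'ω'+b'-b {a} {b} {c} {a'} {b'} {c'} {ω} {ω'} 0<a disc≡d isω 0<a' disc'≡d isω' = begin
      fromℤ (+ 2 ℤ.* a) ⊗ ω                        ≡⟨ solve 2 (λ X B → X := (X :+ B) :- B) refl (fromℤ (+ 2 ℤ.* a) ⊗ ω) (fromℤ b) ⟩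
      fromℤ (+ 2 ℤ.* a) ⊗ ω ⊕ fromℤ b ⊖ fromℤ b    ≡⟨ cong (_⊖ fromℤ b) (trans (2aω+b≡δ {a} {b} {c} {ω} 0<a disc≡d isω)
                                                        (sym (2aω+b≡δ {a'} {b'} {c'} {ω'} 0<a' disc'≡d isω'))) ⟩
      fromℤ (+ 2 ℤ.* a') ⊗ ω' ⊕ fromℤ b' ⊖ fromℤ b
        ≡⟨ solve 3 (λ X B' B → X :+ B' :- B := X :+ (B' :- B)) refl (fromℤ (+ 2 ℤ.* a') ⊗ ω') (fromℤ b') (fromℤ b) ⟩
      fromℤ (+ 2 ℤ.* a') ⊗ ω' ⊕ (fromℤ b' ⊖ fromℤ b) ≡⟨ cong (fromℤ (+ 2 ℤ.* a') ⊗ ω' ⊕_) (sym (fromℤ-- b' b)) ⟩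
      fromℤ (+ 2 ℤ.* a') ⊗ ω' ⊕ fromℤ (b' ℤ.- b)    ∎
      where open ≡-Reasoning

    aω≡m+θ : ∀ {a b c ω} → + 0 ℤ.< a → disc (form a b c) ≡ d → IsOmega d (form a b c) ω →
             ∃ λ m → fromℤ a ⊗ ω ≡ toK (m , + 1)
    aω≡m+θ {a} {b} {c} {ω} 0<a disc≡d isω = m , ⊗-cancelˡ d<0 {fromℤ (+ 2)} (λ ()) (trans twice-aω (sym twice-m+θ))
      where
      open ≡-Reasoning
      m : ℤ
      m = proj₁ (-b-d-even {a} {b} {c} disc≡d)
      2m≡-b-d : + 2 ℤ.* m ≡ ℤ.- b ℤ.- d
      2m≡-b-d = proj₂ (-b-d-even {a} {b} {c} disc≡d)
      A B : K
      A = fromℤ a; B = fromℤ b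
      twice-aω : fromℤ (+ 2) ⊗ (A ⊗ ω) ≡ δ ⊖ B
      twice-aω = begin
        fromℤ (+ 2) ⊗ (A ⊗ ω)
          ≡⟨ solve 4 (λ T A W B → T :* (A :* W) := (T :* A :* W :+ B) :- B) refl (fromℤ (+ 2)) A ω B ⟩
        fromℤ (+ 2) ⊗ A ⊗ ω ⊕ B ⊖ B
          ≡⟨ cong (λ t → t ⊗ ω ⊕ B ⊖ B) (sym (fromℤ-* (+ 2) a)) ⟩
        fromℤ (+ 2 ℤ.* a) ⊗ ω ⊕ B ⊖ B
          ≡⟨ cong (_⊖ B) (2aω+b≡δ {a} {b} {c} {ω} 0<a disc≡d isω) ⟩
        δ ⊖ B ∎
      twice-m+θ : fromℤ (+ 2) ⊗ toK (m , + 1) ≡ δ ⊖ B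
      twice-m+θ = begin
        fromℤ (+ 2) ⊗ (fromℤ m ⊕ fromℤ (+ 1) ⊗ θ)
          ≡⟨ solve 3 (λ T M Θ → T :* (M :+ con (+ 1) :* Θ) := T :* M :+ T :* Θ) refl (fromℤ (+ 2)) (fromℤ m) θ ⟩
        fromℤ (+ 2) ⊗ fromℤ m ⊕ fromℤ (+ 2) ⊗ θ
          ≡⟨ cong₂ _⊕_ (trans (sym (fromℤ-* (+ 2) m)) (cong fromℤ 2m≡-b-d)) 2θ≡d+δ ⟩
        fromℤ (ℤ.- b ℤ.- d) ⊕ (fromℤ d ⊕ δ)
          ≡⟨ cong (_⊕ (fromℤ d ⊕ δ)) (trans (fromℤ-- (ℤ.- b) d) (cong (_⊖ fromℤ d) (fromℤ-neg b))) ⟩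
        (⊝ B ⊖ fromℤ d) ⊕ (fromℤ d ⊕ δ)
          ≡⟨ solve 3 (λ B D Δ → (:- B :- D) :+ (D :+ Δ) := Δ :- B) refl B (fromℤ d) δ ⟩
        δ ⊖ B ∎

    module LatticeRatio (A B ω ω' : K) (p q r s p̃ q̃ r̃ s̃ : ℤ) (B≢0 : B ≢ 0K)
      (Aω∈ : A ⊗ ω ≡ p · (B ⊗ ω') ⊕ q · (B ⊗ 1K)) (A∈ : A ⊗ 1K ≡ r · (B ⊗ ω') ⊕ s · (B ⊗ 1K))
      (Bω'∈ : B ⊗ ω' ≡ p̃ · (A ⊗ ω) ⊕ q̃ · (A ⊗ 1K)) (B∈ : B ⊗ 1K ≡ r̃ · (A ⊗ ω) ⊕ s̃ · (A ⊗ 1K)) where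

      ν μ : K
      ν = comb ω' s r
      μ = comb ω' q p

      private
        factor : ∀ m n x y → m · (B ⊗ x) ⊕ n · (B ⊗ y) ≡ B ⊗ (m · x ⊕ n · y)
        factor m n x y = solve 5 (λ M N B X Y → M :* (B :* X) :+ N :* (B :* Y) := B :* (M :* X :+ N :* Y))
          refl (fromℤ m) (fromℤ n) B x y

        as-comb : ∀ m n → m · ω' ⊕ n · 1K ≡ comb ω' n m
        as-comb m n = solve 3 (λ M N W → M :* W :+ N :* con (+ 1) := N :+ M :* W) refl (fromℤ m) (fromℤ n) ω'

      A≡Bν : A ≡ B ⊗ ν
      A≡Bν = trans (sym (⊗-identityʳ A)) (trans A∈ (trans (factor r s ω' 1K) (cong (B ⊗_) (as-comb r s))))

      Aω≡Bμ : A ⊗ ω ≡ B ⊗ μ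
      Aω≡Bμ = trans Aω∈ (trans (factor p q ω' 1K) (cong (B ⊗_) (as-comb p q)))

      νω≡μ : ν ⊗ ω ≡ μ
      νω≡μ = ⊗-cancelˡ d<0 B≢0 (trans (sym (⊗-assoc B ν ω)) (trans (cong (_⊗ ω) (sym A≡Bν)) Aω≡Bμ))

      ω'≡p̃μ+q̃ν : ω' ≡ p̃ · μ ⊕ q̃ · ν
      ω'≡p̃μ+q̃ν = ⊗-cancelˡ d<0 B≢0 (trans Bω'∈
        (trans (cong₂ (λ x y → p̃ · x ⊕ q̃ · y) Aω≡Bμ (trans (⊗-identityʳ A) A≡Bν)) (factor p̃ q̃ μ ν)))

      1≡r̃μ+s̃ν : 1K ≡ r̃ · μ ⊕ s̃ · ν
      1≡r̃μ+s̃ν = ⊗-cancelˡ d<0 B≢0 (trans B∈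
        (trans (cong₂ (λ x y → r̃ · x ⊕ s̃ · y) Aω≡Bμ (trans (⊗-identityʳ A) A≡Bν)) (factor r̃ s̃ μ ν)))

    module RingOfIntegers (e : ℤ) (4e≡d²-d : + 4 ℤ.* e ≡ d ℤ.* d ℤ.- d) where

      θ-root : IsRoot (form (+ 1) (ℤ.- d) e) θ
      θ-root = ⊗-cancelˡ d<0 {fromℤ (+ 4)} (λ ()) (begin
        fromℤ (+ 4) ⊗ (fromℤ (+ 1) ⊗ θ ⊗ θ ⊕ fromℤ (ℤ.- d) ⊗ θ ⊕ fromℤ e)
          ≡⟨ cong (λ t → fromℤ (+ 4) ⊗ (fromℤ (+ 1) ⊗ θ ⊗ θ ⊕ t ⊗ θ ⊕ fromℤ e)) (fromℤ-neg d) ⟩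
        fromℤ (+ 4) ⊗ (fromℤ (+ 1) ⊗ θ ⊗ θ ⊕ ⊝ D ⊗ θ ⊕ fromℤ e)
          ≡⟨ solve 3 (λ Θ D E → con (+ 4) :* (con (+ 1) :* Θ :* Θ :+ :- D :* Θ :+ E)
               := (con (+ 2) :* Θ) :* (con (+ 2) :* Θ) :- con (+ 2) :* D :* (con (+ 2) :* Θ) :+ con (+ 4) :* E)
               refl θ D (fromℤ e) ⟩
        (fromℤ (+ 2) ⊗ θ) ⊗ (fromℤ (+ 2) ⊗ θ) ⊖ fromℤ (+ 2) ⊗ D ⊗ (fromℤ (+ 2) ⊗ θ) ⊕ fromℤ (+ 4) ⊗ fromℤ e
          ≡⟨ cong₂ (λ t u → t ⊗ t ⊖ fromℤ (+ 2) ⊗ D ⊗ t ⊕ u) 2θ≡d+δ 4e-in-K ⟩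
        (D ⊕ δ) ⊗ (D ⊕ δ) ⊖ fromℤ (+ 2) ⊗ D ⊗ (D ⊕ δ) ⊕ (D ⊗ D ⊖ D)
          ≡⟨ solve 2 (λ D Δ → (D :+ Δ) :* (D :+ Δ) :- con (+ 2) :* D :* (D :+ Δ) :+ (D :* D :- D) := Δ :* Δ :- D)
               refl D δ ⟩
        δ ⊗ δ ⊖ D
          ≡⟨ cong (_⊖ D) δ⊗δ≡d ⟩
        D ⊖ D
          ≡⟨ solve 1 (λ D → D :- D := con (+ 4) :* con (+ 0)) refl D ⟩
        fromℤ (+ 4) ⊗ 0K ∎)
        where
        open ≡-Reasoning
        D : K
        D = fromℤ d
        4e-in-K : fromℤ (+ 4) ⊗ fromℤ e ≡ D ⊗ D ⊖ D
        4e-in-K = trans (sym (fromℤ-* (+ 4) e)) (trans (cong fromℤ 4e≡d²-d)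
                    (trans (fromℤ-- (d ℤ.* d) d) (cong (_⊖ D) (fromℤ-* d d))))

      _∈𝒪 : K → Set
      x ∈𝒪 = ∃ λ o → toK o ≡ x

      ∈𝒪-+ : ∀ {x y} → x ∈𝒪 → y ∈𝒪 → (x ⊕ y) ∈𝒪
      ∈𝒪-+ ((m , n) , refl) ((m' , n') , refl) = (m ℤ.+ m' , n ℤ.+ n') , sym (comb-+ θ m n m' n')

      ∈𝒪-* : ∀ {x y} → x ∈𝒪 → y ∈𝒪 → (x ⊗ y) ∈𝒪
      ∈𝒪-* ((m , n) , refl) ((m' , n') , refl) =
        (+ 1 ℤ.* m ℤ.* m' ℤ.- e ℤ.* n ℤ.* n' , + 1 ℤ.* (m ℤ.* n' ℤ.+ n ℤ.* m') ℤ.- ℤ.- d ℤ.* n ℤ.* n') ,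
        sym (trans (sym (⊗-identityˡ (toK (m , n) ⊗ toK (m' , n')))) (comb-* {+ 1} {ℤ.- d} {e} {θ} θ-root m n m' n'))

      ∈𝒪-scale : ∀ k {x} → x ∈𝒪 → (fromℤ k ⊗ x) ∈𝒪
      ∈𝒪-scale k ((m , n) , refl) = (k ℤ.* m , k ℤ.* n) , sym (comb-scale θ k m n)

      toK-injective : ∀ {m n m' n'} → toK (m , n) ≡ toK (m' , n') → m ≡ m' × n ≡ n'
      toK-injective = comb-injective (λ ())

      ray-congruence : ∀ {N α β a' r s ω'} → PrimeTo N β → CongO N α β → toK α ≡ toK β ⊗ comb ω' s r →
        (∃ λ m' → fromℤ a' ⊗ ω' ≡ toK (m' , + 1)) →
        + N ℤDivisibility.∣ r × + N ℤDivisibility.∣ a' ℤ.* (s ℤ.- + 1)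
      ray-congruence {N} {α} {β} {a'} {r} {s} {ω'} (u , v , uβ+vN≡1) (γ , α-β≡Nγ) α≡βν (m' , a'ω'≡m'+θ) =
        coordinates (∈𝒪-+ (∈𝒪-* (u , refl) (∈𝒪-scale a' (γ , refl))) (∈𝒪-* (v , refl) ζ∈𝒪))
        where
        open ≡-Reasoning
        ζ : K
        ζ = fromℤ a' ⊗ (comb ω' s r ⊖ 1K)
        ζ∈𝒪 : ζ ∈𝒪
        ζ∈𝒪 = (a' ℤ.* (s ℤ.- + 1) ℤ.+ r ℤ.* m' , r ℤ.* + 1) , sym (a'[ν-1]≡ {a'} {m'} {r} {s} {ω'} a'ω'≡m'+θ)
        coordinates : (toK u ⊗ (fromℤ a' ⊗ toK γ) ⊕ toK v ⊗ ζ) ∈𝒪 →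
          + N ℤDivisibility.∣ r × + N ℤDivisibility.∣ a' ℤ.* (s ℤ.- + 1)
        coordinates ((κ₁ , κ₂) , toKκ≡κ) = uncurry (N∣r∧N∣a'[s-1] {N} {a'} {m'} {r} {s} {κ₁} {κ₂}) (toK-injective (begin
          toK (a' ℤ.* (s ℤ.- + 1) ℤ.+ r ℤ.* m' , r ℤ.* + 1)   ≡⟨ proj₂ ζ∈𝒪 ⟩
          ζ                                                   ≡⟨ x[ν-1]-multiple-of-N {N} {u} {v} {γ} {toK α} {toK β}
                                                                   {comb ω' s r} (fromℤ a') uβ+vN≡1 α-β≡Nγ α≡βν ⟩
          fromℤ (+ N) ⊗ (toK u ⊗ (fromℤ a' ⊗ toK γ) ⊕ toK v ⊗ ζ) ≡⟨ cong (fromℤ (+ N) ⊗_) (sym toKκ≡κ) ⟩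
          fromℤ (+ N) ⊗ toK (κ₁ , κ₂)                        ≡⟨ comb-scale θ (+ N) κ₁ κ₂ ⟩
          toK (+ N ℤ.* κ₁ , + N ℤ.* κ₂)                      ∎))

proposition2p7 : (d : ℤ) → ImagQuadDisc d → (N : ℕ) → N ≥ 1 →
    (Q Q' : Form) → InQ N d Q → InQ N d Q' →
    (ω ω' : Field.K d) → IsOmega d Q ω → IsOmega d Q' ω' →
    Field.SameRayClass d N (Field.[_,_] ω (Field.1K d)) (Field.[_,_] ω' (Field.1K d)) →
    Q ∼[ N ] Q'
proposition2p7 d (fundamental , d<0 , _) N _ (form a b c) (form a' b' c')
  (_ , disc≡d , 0<a , _) (_ , disc'≡d , 0<a' , gcd[N,a']≡1) ω ω' isω isω'
  (α , β , _ , β≢0 , _ , β-prime-to-N , α≡β[N] ,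
   ((p , q , αω∈) , (r , s , α∈)) , ((p̃ , q̃ , βω'∈) , (r̃ , s̃ , β∈)))
  = mat p q r s
  , (det≡1 , inj₁ (Γ₁-congruences {N} {a'} {p} {q} {r} {s} gcd[N,a']≡1 det≡1
                     (proj₁ N∣r×N∣a'[s-1]) (proj₂ N∣r×N∣a'[s-1])))
  , transformed-form 0<a (trans disc≡d (sym disc'≡d)) det≡1
  where
  open Field d
  open QuadraticField d
  open Imaginary d<0
  open LatticeRatio (toK α) (toK β) ω ω' p q r s p̃ q̃ r̃ s̃ β≢0 αω∈ α∈ βω'∈ β∈

  sqω'≢0 : sq ω' ≢ 0ℚ
  sqω'≢0 = positive⇒≢0 (ℚ.positive (proj₂ isω'))

  columns : (+ 2 ℤ.* a ℤ.* p ℤ.+ b ℤ.* r ≡ + 2 ℤ.* a' ℤ.* s ℤ.- b' ℤ.* r)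
          × (+ 2 ℤ.* a ℤ.* q ℤ.+ b ℤ.* s ≡ b' ℤ.* s ℤ.- + 2 ℤ.* c' ℤ.* r)
  columns = ratio-columns {a} {b} {a'} {b'} {c'} {p} {q} {r} {s} 0<a'
    (ratio-coefficients {ω} {ω'} {a} {b} {a'} {b'} {c'} {p} {q} {r} {s} sqω'≢0 (proj₁ isω')
    (2aω≡2a'ω'+b'-b {a} {b} {c} {a'} {b'} {c'} 0<a disc≡d isω 0<a' disc'≡d isω') νω≡μ)

  open Transformation a b c a' b' c' p q r s (proj₁ columns) (proj₂ columns)

  det≡1 : det ≡ + 1
  det≡1 = unit-det≡1 0<a 0<a' (subst (ℤ._< + 0) (sym disc'≡d) d<0) {p̃ ℤ.* s̃ ℤ.- q̃ ℤ.* r̃}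
    (det-unit {ω'} {p} {q} {r} {s} {p̃} {q̃} {r̃} {s̃} sqω'≢0 ω'≡p̃μ+q̃ν 1≡r̃μ+s̃ν)

  N∣r×N∣a'[s-1] : + N ℤDivisibility.∣ r × + N ℤDivisibility.∣ a' ℤ.* (s ℤ.- + 1)
  N∣r×N∣a'[s-1] = RingOfIntegers.ray-congruence (proj₁ (4∣d²-d fundamental)) (proj₂ (4∣d²-d fundamental))
    {N} {α} {β} {a'} {r} {s} {ω'} β-prime-to-N α≡β[N] A≡Bν (aω≡m+θ {a'} {b'} {c'} {ω'} 0<a' disc'≡d isω')
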